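{- Let $q=2^h$ and let $\lambda$ be a primitive element of $\mathbb{F}_q$ whose minimal polynomial over $\mathbb{F}_2$ has the form $x^h+c_{h-3}x^{h-3}+\dots+c_1x+c_0$. Write $\mu=\sum_{i=0}^{h-1}\mu_i\lambda^i$, $\mu_i\in\mathbb{F}_2$, and let $\mathcal{A}_0=S_A\cup S_B\cup S_{C,0}\cup S_{D,0}\cup S_{E,0}\subseteq\mathrm{PG}(2,q)$ where $S_A=\{(\mu,1,0)\mid \mu_{h-2}=0,\mu_{h-3}=1\}$, $S_B=\{(\mu,0,1)\mid \mu_{h-1}=0,\mu_{h-2}=1\}$, $S_{C,0}=\{(\mu,1,1)\mid \mu_{h-2}=0,\sum_{i=0}^{h-3}\mu_i=0\}$, $S_{D,0}=\{(\mu,\lambda,1)\mid \mu_{h-1}+\mu_{h-2}=1,\sum_{i=0}^{h-3}\mu_i=0\}$, $S_{E,0}=\{(\mu,\lambda^2,1)\mid \mu_{h-1}=0,\sum_{i=0}^{h-2}\mu_i=0\}$ (a translation KM-arc of type $q/4$ with nucleus $N=(1,0,0)$ and translation line $\ell: Y=\lambda Z$). Then the set consisting of $N$ and the points of $\ell$ not in $\mathcal{A}_0$, viewed in $\mathrm{PG}(1,q)$ via the identification $(x,\lambda z,z)\mapsto(x,z)$, is $\mathrm{PGL}(2,q)$-equivalent to the $\mathbb{F}_2$-linear $(h-2)$-club of rank $h$ $$\mathcal{C}=\{\langle(t_1\lambda+\dots+t_{h-1}\lambda^{h-1},\ t_{h-1}+t_h\lambda)\rangle_{\mathbb{F}_q}: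 t_i\in\mathbb{F}_2,\ (t_1,\dots,t_h)\neq 0\}.$$
   Context: Points of $\mathrm{PG}(2,q)$ are given by homogeneous coordinates $(X,Y,Z)$. A KM-arc of type $t$ is a set of $q+t$ points such that each line meets it in $0$, $2$ or $t$ points, each value occurring; its nucleus is the common point of its $t$-secants. An $\mathbb{F}_2$-linear set of rank $k$ in $\mathrm{PG}(1,q)$ is the set of points defined by the nonzero vectors of a $k$-dimensional $\mathbb{F}_2$-subspace $W$ of $\mathbb{F}_q^2$; the weight of a point $\langle v\rangle$ is $\dim_{\mathbb{F}_2}(W\cap\langle v\rangle_{\mathbb{F}_q})$; an $i$-club of rank $k$ is such a set with one point (the head) of weight $i$ and all others of weight $1$. -}

module Defs where

open import Data.Bool using (Bool; true; false; _xor_; _∧_; _∨_; if_then_else_; not)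
open import Data.Nat using (ℕ; zero; suc; _∸_; _+_; _^_)
open import Data.List using (List; []; _∷_; upTo; map; foldr; length; concatMap)
open import Data.Vec using (Vec; []; _∷_; init; last; replicate; toList; zipWith)
open import Data.Product using (Σ; _×_; _,_; ∃)
open import Data.Sum using (_⊎_)
open import Relation.Binary.PropositionalEquality using (_≡_; _≢_)
open import Relation.Nullary using (¬_)

-- An element μ = Σ_{i<h} μ_i λ^i is stored as its coordinate vector
-- (μ_0, …, μ_{h-1}) ∈ F_2^h.  The field is F_2[x]/(f) with
--   f = x^h + Σ_{i<h} c_i x^i,
-- where c : Vec Bool h lists the low coefficients of f, and λ = class of x.

F : ℕ → Set
F h = Vec Bool h

-- coefficient μ_k (false for k ≥ h)
coef : ∀ {h} → F h → ℕ → Bool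
coef []       k       = false
coef (x ∷ xs) zero    = x
coef (x ∷ xs) (suc k) = coef xs k

parity : List Bool → Bool
parity = foldr _xor_ false

allVecs : (n : ℕ) → List (Vec Bool n)
allVecs zero    = [] ∷ []
allVecs (suc n) = concatMap (λ v → (false ∷ v) ∷ (true ∷ v) ∷ []) (allVecs n)

eqB : Bool → Bool → Bool
eqB a b = not (a xor b)

eqVB : ∀ {n} → Vec Bool n → Vec Bool n → Bool
eqVB []       []       = true
eqVB (a ∷ as) (b ∷ bs) = eqB a b ∧ eqVB as bs

anyL : ∀ {A : Set} → (A → Bool) → List A → Bool
anyL p = foldr (λ a r → p a ∨ r) false

countL : ∀ {A : Set} → (A → Bool) → List A → ℕ
countL p = foldr (λ a r → if p a then suc r else r) 0

oneV : ∀ {h} → F h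
oneV {zero}  = []
oneV {suc m} = true ∷ replicate m false

-- multiplication by x modulo f = x^h + Σ c_i x^i
mulXV : ∀ {h} → Vec Bool h → F h → F h
mulXV {zero}  c x = []
mulXV {suc m} c x =
  zipWith _xor_ (false ∷ init x) (if last x then c else replicate _ false)

module Field {h : ℕ} (c : Vec Bool h) where

  zeroF : F h
  zeroF = replicate _ false

  oneF : F h
  oneF = oneV

  infixl 6 _+F_
  infixl 7 _*F_
  infix 4 _∼₃_ _∼₂_
  _+F_ : F h → F h → F h
  _+F_ = zipWith _xor_

  mulX : F h → F h
  mulX = mulXV c

  -- multiplication: (a_0 + x·rest)·b = a_0·b + x·(rest·b)
  mulL : List Bool → F h → F h
  mulL []       b = zeroF
  mulL (a ∷ as) b = (if a then b else zeroF) +F mulX (mulL as b)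

  _*F_ : F h → F h → F h
  a *F b = mulL (toList a) b

  lam : F h
  lam = mulX oneF

  _^F_ : F h → ℕ → F h
  a ^F zero  = oneF
  a ^F suc k = a *F (a ^F k)

  sumF : List (F h) → F h
  sumF = foldr _+F_ zeroF

  bitF : Bool → F h
  bitF b = if b then oneF else zeroF

  Primitive : Set
  Primitive = ∀ (a : F h) → a ≢ zeroF → ∃ λ k → lam ^F k ≡ a

  -- PG(2,q): nonzero triples up to a nonzero scalar
  V3 : Set
  V3 = F h × F h × F h

  NonZero3 : V3 → Set
  NonZero3 v = v ≢ (zeroF , zeroF , zeroF)

  scale3 : F h → V3 → V3
  scale3 a (x , y , z) = (a *F x , a *F y , a *F z)

  _∼₃_ : V3 → V3 → Set
  u ∼₃ v = Σ (F h) λ a → a ≢ zeroF × u ≡ scale3 a v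

  -- the point sets (membership of the projective point ⟨P⟩)
  S-A : V3 → Set
  S-A P = Σ (F h) λ μ → coef μ (h ∸ 2) ≡ false × coef μ (h ∸ 3) ≡ true
                        × P ∼₃ (μ , oneF , zeroF)

  S-B : V3 → Set
  S-B P = Σ (F h) λ μ → coef μ (h ∸ 1) ≡ false × coef μ (h ∸ 2) ≡ true
                        × P ∼₃ (μ , zeroF , oneF)

  S-C0 : V3 → Set
  S-C0 P = Σ (F h) λ μ → coef μ (h ∸ 2) ≡ false
                         × parity (map (coef μ) (upTo (h ∸ 2))) ≡ false
                         × P ∼₃ (μ , oneF , oneF)

  S-D0 : V3 → Set
  S-D0 P = Σ (F h) λ μ → (coef μ (h ∸ 1) xor coef μ (h ∸ 2)) ≡ true
                         × parity (map (coef μ) (upTo (h ∸ 2))) ≡ false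
                         × P ∼₃ (μ , lam , oneF)

  S-E0 : V3 → Set
  S-E0 P = Σ (F h) λ μ → coef μ (h ∸ 1) ≡ false
                         × parity (map (coef μ) (upTo (h ∸ 1))) ≡ false
                         × P ∼₃ (μ , lam ^F 2 , oneF)

  A0 : V3 → Set
  A0 P = S-A P ⊎ S-B P ⊎ S-C0 P ⊎ S-D0 P ⊎ S-E0 P

  N : V3
  N = (oneF , zeroF , zeroF)

  onℓ : V3 → Set
  onℓ (x , y , z) = y ≡ lam *F z

  V2 : Set
  V2 = F h × F h

  NonZero2 : V2 → Set
  NonZero2 v = v ≢ (zeroF , zeroF)

  scale2 : F h → V2 → V2
  scale2 a (x , z) = (a *F x , a *F z)

  _∼₂_ : V2 → V2 → Set
  u ∼₂ v = Σ (F h) λ a → a ≢ zeroF × u ≡ scale2 a v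

  lift : V2 → V3
  lift (x , z) = (x , lam *F z , z)

  T : V2 → Set
  T v = lift v ∼₃ N ⊎ (onℓ (lift v) × ¬ A0 (lift v))

  act : F h → F h → F h → F h → V2 → V2
  act a b c' d (x , z) = (a *F x +F b *F z , c' *F x +F d *F z)

  -- determinant (characteristic 2: ad - bc = ad + bc)
  det : F h → F h → F h → F h → F h
  det a b c' d = a *F d +F b *F c'

  -- The F_2-linear set 𝒞.  t = (t_1,…,t_h) is stored 0-indexed as
  -- a vector s with s_j = t_{j+1}.
  -- w(t) = (t_1 λ + … + t_{h-1} λ^{h-1}, t_{h-1} + t_h λ)
  wvec : Vec Bool h → V2
  wvec s = ( sumF (map (λ j → bitF (coef s j) *F (lam ^F suc j)) (upTo (h ∸ 1)))
           , bitF (coef s (h ∸ 2)) +F (bitF (coef s (h ∸ 1)) *F lam) )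

  inC : V2 → Set
  inC w = Σ (Vec Bool h) λ s → s ≢ replicate h false × w ∼₂ wvec s

  eqV2B : V2 → V2 → Bool
  eqV2B (x , z) (x' , z') = eqVB x x' ∧ eqVB z z'

  -- |W ∩ ⟨v⟩_{F_q}|, W = {w(t) : t ∈ F_2^h}; the weight of ⟨v⟩ is its log₂
  -- (W has size 2^h when w is injective, i.e. rank h)
  cardW∩ : V2 → ℕ
  cardW∩ v = countL (λ s → anyL (λ a → eqV2B (wvec s) (scale2 a v)) (allVecs h))
                    (allVecs h)

  -- 𝒞 has rank h: dim_{F_2} W = h, i.e. t ↦ w(t) is injective (it is F_2-linear)
  RankH : Set
  RankH = ∀ (s : Vec Bool h) → wvec s ≡ (zeroF , zeroF) → s ≡ replicate h false

  -- 𝒞 is an i-club: one head of weight i, all other points of weight 1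
  Club : ℕ → Set
  Club i = Σ V2 λ v₀ → NonZero2 v₀ × inC v₀ × cardW∩ v₀ ≡ 2 ^ i
           × (∀ v → NonZero2 v → inC v → ¬ (v ∼₂ v₀) → cardW∩ v ≡ 2 ^ 1)

module Submission where

-- F_q = F₂[x]/(f) is modelled (Defs) by coordinate vectors in F₂ʰ, so the
-- proof is linear algebra over F₂ driven by two F₂-linear functionals, the
-- top coordinate `last` and the parity `par`.

open import Defs
open import Data.Bool using (Bool; true; false; not; _xor_; _∧_; _∨_; if_then_else_)
open import Data.Bool.Properties using (xor-same; xor-assoc; xor-comm; xor-identityˡ; xor-identityʳ; ∨-identityʳ; ∨-zeroʳ; ∧-zeroʳ) renaming (_≟_ to _≟B_)
open import Data.Nat using (ℕ; zero; suc; _+_; _^_; _≤_; _∸_; z≤n; s≤s)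
open import Data.Nat.Properties using (+-suc; +-identityʳ; ≤-refl; m≤n⇒m≤1+n)
open import Data.List using (List; []; _∷_; length; applyUpTo; upTo; map; concatMap)
open import Data.List.Properties using (map-upTo)
open import Data.Vec using (Vec; []; _∷_; head; tail; init; last; replicate; toList; zipWith; _∷ʳ_; initLast)
open import Data.Vec.Properties using (init-∷ʳ; last-∷ʳ; zipWith-assoc; zipWith-comm; zipWith-identityˡ; zipWith-identityʳ; ≡-dec)
open import Data.Product using (Σ; ∃; _×_; _,_; proj₁; proj₂)
open import Data.Sum using (_⊎_; inj₁; inj₂)
open import Data.Empty using (⊥-elim)
open import Relation.Nullary using (¬_; yes; no)
open import Relation.Binary.PropositionalEquality
open import Function.Bundles using (_⇔_; mk⇔; Equivalence)
open import Function.Construct.Composition using (_⇔-∘_)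
open import Function.Construct.Symmetry using (⇔-sym)
open ≡-Reasoning

module Bits where

  infixl 6 _⊕_
  infixr 7 _·_

  _⊕_ : ∀ {n} → Vec Bool n → Vec Bool n → Vec Bool n
  _⊕_ = zipWith _xor_

  𝟘 : ∀ {n} → Vec Bool n
  𝟘 {n} = replicate n false

  ⊕-comm : ∀ {n} (a b : Vec Bool n) → a ⊕ b ≡ b ⊕ a
  ⊕-comm = zipWith-comm xor-comm

  ⊕-assoc : ∀ {n} (a b d : Vec Bool n) → (a ⊕ b) ⊕ d ≡ a ⊕ (b ⊕ d)
  ⊕-assoc = zipWith-assoc xor-assoc

  ⊕-identityˡ : ∀ {n} (a : Vec Bool n) → 𝟘 ⊕ a ≡ a
  ⊕-identityˡ = zipWith-identityˡ xor-identityˡ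

  ⊕-identityʳ : ∀ {n} (a : Vec Bool n) → a ⊕ 𝟘 ≡ a
  ⊕-identityʳ = zipWith-identityʳ xor-identityʳ

  ⊕-self : ∀ {n} (a : Vec Bool n) → a ⊕ a ≡ 𝟘
  ⊕-self []      = refl
  ⊕-self (x ∷ a) = cong₂ _∷_ (xor-same x) (⊕-self a)

  ⊕-cancel : ∀ {n} (a b : Vec Bool n) → a ⊕ b ≡ 𝟘 → a ≡ b
  ⊕-cancel a b e = begin
    a            ≡⟨ sym (⊕-identityʳ a) ⟩
    a ⊕ 𝟘        ≡⟨ cong (a ⊕_) (sym (⊕-self b)) ⟩
    a ⊕ (b ⊕ b)  ≡⟨ sym (⊕-assoc a b b) ⟩
    (a ⊕ b) ⊕ b  ≡⟨ cong (_⊕ b) e ⟩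
    𝟘 ⊕ b        ≡⟨ ⊕-identityˡ b ⟩
    b            ∎

  ⊕-interchange : ∀ {n} (a b d e : Vec Bool n) → (a ⊕ b) ⊕ (d ⊕ e) ≡ (a ⊕ d) ⊕ (b ⊕ e)
  ⊕-interchange a b d e = begin
    (a ⊕ b) ⊕ (d ⊕ e)  ≡⟨ ⊕-assoc a b (d ⊕ e) ⟩
    a ⊕ (b ⊕ (d ⊕ e))  ≡⟨ cong (a ⊕_) (sym (⊕-assoc b d e)) ⟩
    a ⊕ ((b ⊕ d) ⊕ e)  ≡⟨ cong (λ t → a ⊕ (t ⊕ e)) (⊕-comm b d) ⟩
    a ⊕ ((d ⊕ b) ⊕ e)  ≡⟨ cong (a ⊕_) (⊕-assoc d b e) ⟩
    a ⊕ (d ⊕ (b ⊕ e))  ≡⟨ sym (⊕-assoc a d (b ⊕ e)) ⟩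
    (a ⊕ d) ⊕ (b ⊕ e)  ∎

  _·_ : ∀ {n} → Bool → Vec Bool n → Vec Bool n
  b · v = if b then v else 𝟘

  ·-distrib-xor : ∀ {n} (a b : Bool) (v : Vec Bool n) → (a xor b) · v ≡ a · v ⊕ b · v
  ·-distrib-xor false b    v = sym (⊕-identityˡ _)
  ·-distrib-xor true false v = sym (⊕-identityʳ v)
  ·-distrib-xor true true  v = sym (⊕-self v)

  ·-𝟘 : ∀ {n} (a : Bool) → a · 𝟘 {n} ≡ 𝟘
  ·-𝟘 false = refl
  ·-𝟘 true  = refl

  ·-distrib-⊕ : ∀ {n} (a : Bool) (v w : Vec Bool n) → a · (v ⊕ w) ≡ a · v ⊕ a · w
  ·-distrib-⊕ false v w = sym (⊕-identityˡ _)
  ·-distrib-⊕ true  v w = refl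

  penult : ∀ {A : Set} {n} → Vec A (suc (suc n)) → A
  penult v = last (init v)

  par : ∀ {n} → Vec Bool n → Bool
  par v = parity (toList v)

  init-last : ∀ {A : Set} {n} (v : Vec A (suc n)) → init v ∷ʳ last v ≡ v
  init-last v = sym (proj₂ (proj₂ (initLast v)))

  init-last-ext : ∀ {A : Set} {n} (u v : Vec A (suc n)) → init u ≡ init v → last u ≡ last v → u ≡ v
  init-last-ext u v ei el = begin
    u                ≡⟨ sym (init-last u) ⟩
    init u ∷ʳ last u ≡⟨ cong₂ _∷ʳ_ ei el ⟩
    init v ∷ʳ last v ≡⟨ init-last v ⟩
    v                ∎

  init-⊕ : ∀ {n} (a b : Vec Bool (suc n)) → init (a ⊕ b) ≡ init a ⊕ init b
  init-⊕ {zero}  (x ∷ []) (y ∷ []) = refl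
  init-⊕ {suc n} (x ∷ a)  (y ∷ b)  = cong ((x xor y) ∷_) (init-⊕ a b)

  last-⊕ : ∀ {n} (a b : Vec Bool (suc n)) → last (a ⊕ b) ≡ last a xor last b
  last-⊕ {zero}  (x ∷ []) (y ∷ []) = refl
  last-⊕ {suc n} (x ∷ a)  (y ∷ b)  = last-⊕ a b

  penult-⊕ : ∀ {n} (a b : Vec Bool (suc (suc n))) → penult (a ⊕ b) ≡ penult a xor penult b
  penult-⊕ a b = trans (cong last (init-⊕ a b)) (last-⊕ (init a) (init b))

  init-𝟘 : ∀ {n} → init (𝟘 {suc n}) ≡ 𝟘
  init-𝟘 {zero}  = refl
  init-𝟘 {suc n} = cong (false ∷_) (init-𝟘 {n})

  last-𝟘 : ∀ {n} → last (𝟘 {suc n}) ≡ false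
  last-𝟘 {zero}  = refl
  last-𝟘 {suc n} = last-𝟘 {n}

  last-· : ∀ {n} a (v : Vec Bool (suc n)) → last (a · v) ≡ (a ∧ last v)
  last-· {n} false v = last-𝟘 {n}
  last-· true v = refl

  par-⊕ : ∀ {n} (a b : Vec Bool n) → par (a ⊕ b) ≡ par a xor par b
  par-⊕ []      []      = refl
  par-⊕ (x ∷ a) (y ∷ b) = begin
    (x xor y) xor par (a ⊕ b)         ≡⟨ cong ((x xor y) xor_) (par-⊕ a b) ⟩
    (x xor y) xor (par a xor par b)   ≡⟨ xor-assoc x y _ ⟩
    x xor (y xor (par a xor par b))   ≡⟨ cong (x xor_) (sym (xor-assoc y (par a) _)) ⟩
    x xor ((y xor par a) xor par b)   ≡⟨ cong (λ t → x xor (t xor par b)) (xor-comm y (par a)) ⟩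
    x xor ((par a xor y) xor par b)   ≡⟨ cong (x xor_) (xor-assoc (par a) y _) ⟩
    x xor (par a xor (y xor par b))   ≡⟨ sym (xor-assoc x _ _) ⟩
    (x xor par a) xor (y xor par b)   ∎

  par-𝟘 : ∀ {n} → par (𝟘 {n}) ≡ false
  par-𝟘 {zero}  = refl
  par-𝟘 {suc n} = par-𝟘 {n}

  par-· : ∀ {n} a (v : Vec Bool n) → par (a · v) ≡ (a ∧ par v)
  par-· {n} false v = par-𝟘 {n}
  par-· true v = refl

  par-init : ∀ {n} (v : Vec Bool (suc n)) → par v ≡ par (init v) xor last v
  par-init {zero}  (x ∷ []) = xor-identityʳ x
  par-init {suc n} (x ∷ v)  = trans (cong (x xor_) (par-init v)) (sym (xor-assoc x _ _))

  xor-cancel : ∀ a r → (a xor r) xor a ≡ r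
  xor-cancel false r     = xor-identityʳ r
  xor-cancel true  false = refl
  xor-cancel true  true  = refl

  -- Prefix sums G with seed a: Gᵢ = a + R₀ + … + Rᵢ.  They invert the
  -- difference operator: G ⊕ (a, G₀, …, G_{n-2}) = R.
  prefixSums : ∀ {n} → Bool → Vec Bool n → Vec Bool n
  prefixSums a []       = []
  prefixSums a (r ∷ rs) = (a xor r) ∷ prefixSums (a xor r) rs

  prefixSums-difference : ∀ {n} a (R : Vec Bool n) → prefixSums a R ⊕ init (a ∷ prefixSums a R) ≡ R
  prefixSums-difference a []           = refl
  prefixSums-difference a (r ∷ [])     = cong (_∷ []) (xor-cancel a r)
  prefixSums-difference a (r ∷ r' ∷ R) =
    cong₂ _∷_ (xor-cancel a r) (prefixSums-difference (a xor r) (r' ∷ R))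

  last-prefixSums : ∀ {n} a (R : Vec Bool (suc n)) → last (prefixSums a R) ≡ a xor par R
  last-prefixSums {zero}  a (r ∷ []) = cong (a xor_) (sym (xor-identityʳ r))
  last-prefixSums {suc n} a (r ∷ R)  = trans (last-prefixSums (a xor r) R) (xor-assoc a r _)

  init-prefixSums : ∀ {n} a (R : Vec Bool (suc n)) → init (prefixSums a R) ≡ prefixSums a (init R)
  init-prefixSums {zero}  a (r ∷ []) = refl
  init-prefixSums {suc n} a (r ∷ R)  = cong ((a xor r) ∷_) (init-prefixSums (a xor r) R)

  coef-last : ∀ {n} (v : Vec Bool (suc n)) → coef v n ≡ last v
  coef-last {zero}  (x ∷ []) = refl
  coef-last {suc n} (x ∷ v)  = coef-last v

  coef-penult : ∀ {n} (v : Vec Bool (suc (suc n))) → coef v n ≡ penult v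
  coef-penult {zero}  (x ∷ y ∷ []) = refl
  coef-penult {suc n} (x ∷ v)      = coef-penult v

  coefs-init-init : ∀ {n} (v : Vec Bool (suc (suc n))) → applyUpTo (coef v) n ≡ toList (init (init v))
  coefs-init-init {zero}  (x ∷ y ∷ []) = refl
  coefs-init-init {suc n} (x ∷ v)      = cong (x ∷_) (coefs-init-init v)

  coefs-init : ∀ {n} (v : Vec Bool (suc n)) → applyUpTo (coef v) n ≡ toList (init v)
  coefs-init {zero}  (x ∷ []) = refl
  coefs-init {suc n} (x ∷ v)  = cong (x ∷_) (coefs-init v)

  parity-coefs : ∀ {n} (v : Vec Bool (suc (suc n))) → parity (map (coef v) (upTo n)) ≡ par (init (init v))
  parity-coefs {n} v = cong parity (trans (map-upTo (coef v) n) (coefs-init-init v))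

module Enumeration where

  bool-ext : ∀ {b d : Bool} → (b ≡ true ⇔ d ≡ true) → b ≡ d
  bool-ext {false} {false} _ = refl
  bool-ext {false} {true}  e = Equivalence.from e refl
  bool-ext {true}  {false} e = sym (Equivalence.to e refl)
  bool-ext {true}  {true}  _ = refl

  countL-cong : ∀ {A : Set} {p q : A → Bool} (l : List A) → (∀ x → p x ≡ q x) → countL p l ≡ countL q l
  countL-cong []      e = refl
  countL-cong (x ∷ l) e rewrite e x | countL-cong l e = refl

  count-⇔ : ∀ {A : Set} {p q : A → Bool} (l : List A) → (∀ x → p x ≡ true ⇔ q x ≡ true) → countL p l ≡ countL q l
  count-⇔ l e = countL-cong l (λ x → bool-ext (e x))

  count-false : ∀ {A : Set} (l : List A) → countL (λ _ → false) l ≡ 0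
  count-false []      = refl
  count-false (x ∷ l) = count-false l

  count-split : ∀ {n} (p : Vec Bool (suc n) → Bool) →
    countL p (allVecs (suc n)) ≡ countL (λ v → p (false ∷ v)) (allVecs n) + countL (λ v → p (true ∷ v)) (allVecs n)
  count-split {n} p = go (allVecs n)
    where
    go : (L : List (Vec Bool n)) →
      countL p (concatMap (λ v → (false ∷ v) ∷ (true ∷ v) ∷ []) L)
        ≡ countL (λ v → p (false ∷ v)) L + countL (λ v → p (true ∷ v)) L
    go [] = refl
    go (v ∷ L) with p (false ∷ v) | p (true ∷ v)
    ... | false | false = go L
    ... | true  | false = cong suc (go L)
    ... | false | true  = trans (cong suc (go L)) (sym (+-suc _ _))
    ... | true  | true  = cong suc (trans (cong suc (go L)) (sym (+-suc _ _)))

  eqB-refl : ∀ x → eqB x x ≡ true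
  eqB-refl false = refl
  eqB-refl true  = refl

  eqVB-refl : ∀ {n} (a : Vec Bool n) → eqVB a a ≡ true
  eqVB-refl []      = refl
  eqVB-refl (x ∷ a) rewrite eqB-refl x = eqVB-refl a

  eqVB-sound : ∀ {n} (a b : Vec Bool n) → eqVB a b ≡ true → a ≡ b
  eqVB-sound []          []          _  = refl
  eqVB-sound (false ∷ a) (false ∷ b) e  = cong (false ∷_) (eqVB-sound a b e)
  eqVB-sound (true ∷ a)  (true ∷ b)  e  = cong (true ∷_) (eqVB-sound a b e)
  eqVB-sound (false ∷ a) (true ∷ b)  ()
  eqVB-sound (true ∷ a)  (false ∷ b) ()

  eqVB-complete : ∀ {n} {a b : Vec Bool n} → a ≡ b → eqVB a b ≡ true
  eqVB-complete {a = a} refl = eqVB-refl a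

  ∨-introˡ : ∀ {x} y → x ≡ true → (x ∨ y) ≡ true
  ∨-introˡ y refl = refl

  ∨-introʳ : ∀ x {y} → y ≡ true → (x ∨ y) ≡ true
  ∨-introʳ x refl = ∨-zeroʳ x

  ∨-elim : ∀ {x y} → (x ∨ y) ≡ true → x ≡ true ⊎ y ≡ true
  ∨-elim {true}  _ = inj₁ refl
  ∨-elim {false} e = inj₂ e

  count-singleton : ∀ {n} (a : Vec Bool n) → countL (λ v → eqVB v a) (allVecs n) ≡ 1
  count-singleton []               = refl
  count-singleton {suc n} (false ∷ a) = trans (count-split (λ v → eqVB v (false ∷ a)))
    (cong₂ _+_ (count-singleton a) (count-false (allVecs n)))
  count-singleton {suc n} (true ∷ a)  = trans (count-split (λ v → eqVB v (true ∷ a)))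
    (cong₂ _+_ (count-false (allVecs n)) (count-singleton a))

  count-pair : ∀ {n} (a b : Vec Bool n) → a ≢ b → countL (λ v → eqVB v a ∨ eqVB v b) (allVecs n) ≡ 2
  count-pair [] [] a≢b = ⊥-elim (a≢b refl)
  count-pair {suc n} (false ∷ a) (false ∷ b) a≢b = trans (count-split (λ v → eqVB v (false ∷ a) ∨ eqVB v (false ∷ b)))
    (cong₂ _+_ (count-pair a b (λ e → a≢b (cong (false ∷_) e))) (count-false (allVecs n)))
  count-pair {suc n} (true ∷ a) (true ∷ b) a≢b = trans (count-split (λ v → eqVB v (true ∷ a) ∨ eqVB v (true ∷ b)))
    (cong₂ _+_ (count-false (allVecs n)) (count-pair a b (λ e → a≢b (cong (true ∷_) e))))
  count-pair {suc n} (false ∷ a) (true ∷ b) _ = trans (count-split (λ v → eqVB v (false ∷ a) ∨ eqVB v (true ∷ b)))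
    (cong₂ _+_ (trans (countL-cong (allVecs n) (λ v → ∨-identityʳ _)) (count-singleton a)) (count-singleton b))
  count-pair {suc n} (true ∷ a) (false ∷ b) _ = trans (count-split (λ v → eqVB v (true ∷ a) ∨ eqVB v (false ∷ b)))
    (cong₂ _+_ (count-singleton b) (trans (countL-cong (allVecs n) (λ v → ∨-identityʳ _)) (count-singleton a)))

  lastTwoZero : ∀ {n} → Vec Bool (suc (suc n)) → Bool
  lastTwoZero v = not (Bits.penult v) ∧ not (last v)

  count-lastTwoZero : ∀ n → countL lastTwoZero (allVecs (suc (suc n))) ≡ 2 ^ n
  count-lastTwoZero zero    = refl
  count-lastTwoZero (suc n) = trans (count-split (lastTwoZero {suc n}))
    (trans (cong₂ _+_ (count-lastTwoZero n) (count-lastTwoZero n)) (cong (2 ^ n +_) (sym (+-identityʳ (2 ^ n)))))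

  anyL-sound : ∀ {A : Set} (p : A → Bool) (l : List A) → anyL p l ≡ true → ∃ λ a → p a ≡ true
  anyL-sound p []      ()
  anyL-sound p (x ∷ l) e with p x in eq
  ... | true  = x , eq
  ... | false = anyL-sound p l e

  anyL-complete : ∀ {n} (p : Vec Bool n → Bool) (a : Vec Bool n) → p a ≡ true → anyL p (allVecs n) ≡ true
  anyL-complete {zero}  p [] e rewrite e = refl
  anyL-complete {suc n} p (x ∷ a) e =
    trans (anyL-pairs (allVecs n)) (anyL-complete (λ v → p (false ∷ v) ∨ p (true ∷ v)) a (either x e))
    where
    anyL-pairs : (L : List (Vec Bool n)) →
      anyL p (concatMap (λ v → (false ∷ v) ∷ (true ∷ v) ∷ []) L) ≡ anyL (λ v → p (false ∷ v) ∨ p (true ∷ v)) L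
    anyL-pairs [] = refl
    anyL-pairs (v ∷ L) with p (false ∷ v) | p (true ∷ v)
    ... | true  | _     = refl
    ... | false | true  = refl
    ... | false | false = anyL-pairs L
    either : ∀ x → p (x ∷ a) ≡ true → (p (false ∷ a) ∨ p (true ∷ a)) ≡ true
    either false e rewrite e = refl
    either true  e rewrite e = ∨-zeroʳ _

-- Bit lists read as vectors of a fixed length, padded with zeros; this is
-- how Horner evaluation of a bit list at 1 is described.
module Padding where
  open Bits

  padL : List Bool → (n : ℕ) → Vec Bool n
  padL l       zero    = []
  padL []      (suc n) = false ∷ padL [] n
  padL (x ∷ l) (suc n) = x ∷ padL l n

  padL-[] : ∀ n → padL [] n ≡ 𝟘
  padL-[] zero    = refl
  padL-[] (suc n) = cong (false ∷_) (padL-[] n)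

  init-padL : ∀ l n → init (padL l (suc n)) ≡ padL l n
  init-padL []      zero    = refl
  init-padL (x ∷ l) zero    = refl
  init-padL []      (suc n) = cong (false ∷_) (init-padL [] n)
  init-padL (x ∷ l) (suc n) = cong (x ∷_) (init-padL l n)

  last-padL : ∀ l n → length l ≤ n → last (padL l (suc n)) ≡ false
  last-padL []      zero    _       = refl
  last-padL []      (suc n) _       = last-padL [] n z≤n
  last-padL (x ∷ l) (suc n) (s≤s p) = last-padL l n p

  padL-toList : ∀ {n} (v : Vec Bool n) → padL (toList v) n ≡ v
  padL-toList []      = refl
  padL-toList (x ∷ v) = cong (x ∷_) (padL-toList v)

  padL-toList-∷ʳ : ∀ {n} (w : Vec Bool n) → padL (toList w) (suc n) ≡ w ∷ʳ false
  padL-toList-∷ʳ []      = refl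
  padL-toList-∷ʳ (x ∷ w) = cong (x ∷_) (padL-toList-∷ʳ w)

  length-toList : ∀ {A : Set} {n} (v : Vec A n) → length (toList v) ≡ n
  length-toList []      = refl
  length-toList (x ∷ v) = cong suc (length-toList v)

-- Multiplication a *F b is Horner evaluation of the bits of a at b, so
-- the ring laws reduce to linearity of mulX and induction on bit lists.
module QuotientRing {m : ℕ} (c : Vec Bool (suc m)) where
  open Field c
  open Bits
  open Padding

  mulX-⊕ : ∀ a b → mulX (a ⊕ b) ≡ mulX a ⊕ mulX b
  mulX-⊕ a b = begin
    (false ∷ init (a ⊕ b)) ⊕ last (a ⊕ b) · c
      ≡⟨ cong₂ (λ u w → (false ∷ u) ⊕ w · c) (init-⊕ a b) (last-⊕ a b) ⟩
    ((false ∷ init a) ⊕ (false ∷ init b)) ⊕ (last a xor last b) · c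
      ≡⟨ cong (((false ∷ init a) ⊕ (false ∷ init b)) ⊕_) (·-distrib-xor (last a) (last b) c) ⟩
    ((false ∷ init a) ⊕ (false ∷ init b)) ⊕ (last a · c ⊕ last b · c)
      ≡⟨ ⊕-interchange _ _ _ _ ⟩
    mulX a ⊕ mulX b ∎

  mulX-𝟘 : mulX 𝟘 ≡ 𝟘
  mulX-𝟘 = begin
    (false ∷ init (𝟘 {suc m})) ⊕ last (𝟘 {suc m}) · c
      ≡⟨ cong₂ (λ u w → (false ∷ u) ⊕ w · c) (init-𝟘 {m}) (last-𝟘 {m}) ⟩
    (false ∷ 𝟘) ⊕ 𝟘 ≡⟨ ⊕-identityʳ _ ⟩
    𝟘 ∎

  mulX-shift : ∀ w → last w ≡ false → mulX w ≡ false ∷ init w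
  mulX-shift w e = trans (cong (λ b → (false ∷ init w) ⊕ b · c) e) (⊕-identityʳ _)

  mulL-zeroʳ : ∀ as → mulL as 𝟘 ≡ 𝟘
  mulL-zeroʳ []       = refl
  mulL-zeroʳ (a ∷ as) = begin
    a · 𝟘 ⊕ mulX (mulL as 𝟘) ≡⟨ cong₂ _⊕_ (·-𝟘 a) (trans (cong mulX (mulL-zeroʳ as)) mulX-𝟘) ⟩
    𝟘 ⊕ 𝟘                    ≡⟨ ⊕-self 𝟘 ⟩
    𝟘                        ∎

  mulL-⊕ʳ : ∀ as b d → mulL as (b ⊕ d) ≡ mulL as b ⊕ mulL as d
  mulL-⊕ʳ []       b d = sym (⊕-identityˡ _)
  mulL-⊕ʳ (a ∷ as) b d = begin
    a · (b ⊕ d) ⊕ mulX (mulL as (b ⊕ d))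
      ≡⟨ cong₂ _⊕_ (·-distrib-⊕ a b d) (trans (cong mulX (mulL-⊕ʳ as b d)) (mulX-⊕ _ _)) ⟩
    (a · b ⊕ a · d) ⊕ (mulX (mulL as b) ⊕ mulX (mulL as d)) ≡⟨ ⊕-interchange _ _ _ _ ⟩
    mulL (a ∷ as) b ⊕ mulL (a ∷ as) d ∎

  ·-mulX : ∀ a b → a · mulX b ≡ mulX (a · b)
  ·-mulX false b = sym mulX-𝟘
  ·-mulX true  b = refl

  mulL-mulX : ∀ as b → mulL as (mulX b) ≡ mulX (mulL as b)
  mulL-mulX []       b = sym mulX-𝟘
  mulL-mulX (a ∷ as) b = begin
    a · mulX b ⊕ mulX (mulL as (mulX b))  ≡⟨ cong₂ _⊕_ (·-mulX a b) (cong mulX (mulL-mulX as b)) ⟩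
    mulX (a · b) ⊕ mulX (mulX (mulL as b)) ≡⟨ sym (mulX-⊕ _ _) ⟩
    mulX (mulL (a ∷ as) b)                 ∎

  mulL-· : ∀ as a v → mulL as (a · v) ≡ a · mulL as v
  mulL-· as false v = mulL-zeroʳ as
  mulL-· as true  v = refl

  mulL-zeroˡ : ∀ n b → mulL (toList (𝟘 {n})) b ≡ 𝟘
  mulL-zeroˡ zero    b = refl
  mulL-zeroˡ (suc n) b = trans (⊕-identityˡ _) (trans (cong mulX (mulL-zeroˡ n b)) mulX-𝟘)

  mulL-one : ∀ l → length l ≤ suc m → mulL l oneF ≡ padL l (suc m)
  mulL-one []      _       = sym (padL-[] (suc m))
  mulL-one (x ∷ l) (s≤s p) = begin
    x · oneF ⊕ mulX (mulL l oneF)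
      ≡⟨ cong (λ t → x · oneF ⊕ mulX t) (mulL-one l (m≤n⇒m≤1+n p)) ⟩
    x · oneF ⊕ mulX (padL l (suc m))
      ≡⟨ cong (x · oneF ⊕_) (mulX-shift (padL l (suc m)) (last-padL l m p)) ⟩
    x · oneF ⊕ (false ∷ init (padL l (suc m)))
      ≡⟨ cong (λ u → x · oneF ⊕ (false ∷ u)) (init-padL l m) ⟩
    x · oneF ⊕ (false ∷ padL l m) ≡⟨ put x ⟩
    x ∷ padL l m ∎
    where
    put : ∀ x → x · oneF ⊕ (false ∷ padL l m) ≡ x ∷ padL l m
    put false = ⊕-identityˡ _
    put true  = cong (true ∷_) (⊕-identityˡ _)

  *-oneʳ : ∀ a → a *F oneF ≡ a
  *-oneʳ a = trans (mulL-one (toList a) (subst (_≤ suc m) (sym (length-toList a)) ≤-refl)) (padL-toList a)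

  mulL-factor : ∀ as b → mulL as b ≡ b *F mulL as oneF
  mulL-factor []       b = sym (mulL-zeroʳ (toList b))
  mulL-factor (a ∷ as) b = begin
    a · b ⊕ mulX (mulL as b)
      ≡⟨ cong₂ (λ u w → a · u ⊕ mulX w) (sym (*-oneʳ b)) (mulL-factor as b) ⟩
    a · (b *F oneF) ⊕ mulX (b *F mulL as oneF)
      ≡⟨ cong₂ _⊕_ (sym (mulL-· (toList b) a oneF)) (sym (mulL-mulX (toList b) _)) ⟩
    b *F (a · oneF) ⊕ b *F mulX (mulL as oneF) ≡⟨ sym (mulL-⊕ʳ (toList b) _ _) ⟩
    b *F mulL (a ∷ as) oneF ∎

  *-comm : ∀ a b → a *F b ≡ b *F a
  *-comm a b = trans (mulL-factor (toList a) b) (cong (b *F_) (*-oneʳ a))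

  *-oneˡ : ∀ a → oneF *F a ≡ a
  *-oneˡ a = trans (*-comm oneF a) (*-oneʳ a)

  *-zeroˡ : ∀ a → zeroF *F a ≡ zeroF
  *-zeroˡ a = mulL-zeroˡ (suc m) a

  *-zeroʳ : ∀ a → a *F zeroF ≡ zeroF
  *-zeroʳ a = trans (*-comm a zeroF) (*-zeroˡ a)

  *-distribˡ : ∀ a b d → a *F (b ⊕ d) ≡ a *F b ⊕ a *F d
  *-distribˡ a = mulL-⊕ʳ (toList a)

  *-distribʳ : ∀ a b d → (b ⊕ d) *F a ≡ b *F a ⊕ d *F a
  *-distribʳ a b d = begin
    (b ⊕ d) *F a        ≡⟨ *-comm _ a ⟩
    a *F (b ⊕ d)        ≡⟨ *-distribˡ a b d ⟩
    a *F b ⊕ a *F d     ≡⟨ cong₂ _⊕_ (*-comm a b) (*-comm a d) ⟩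
    b *F a ⊕ d *F a     ∎

  *-mulXʳ : ∀ a b → a *F mulX b ≡ mulX (a *F b)
  *-mulXʳ a = mulL-mulX (toList a)

  *-mulXˡ : ∀ a b → mulX a *F b ≡ mulX (a *F b)
  *-mulXˡ a b = trans (*-comm _ b) (trans (*-mulXʳ b a) (cong mulX (*-comm b a)))

  ·-* : ∀ x b d → (x · b) *F d ≡ x · (b *F d)
  ·-* false b d = *-zeroˡ d
  ·-* true  b d = refl

  *-assoc : ∀ a b d → (a *F b) *F d ≡ a *F (b *F d)
  *-assoc a b d = go (toList a)
    where
    go : ∀ as → mulL (toList (mulL as b)) d ≡ mulL as (b *F d)
    go []       = mulL-zeroˡ (suc m) d
    go (x ∷ as) = begin
      (x · b ⊕ mulX (mulL as b)) *F d          ≡⟨ *-distribʳ d (x · b) (mulX (mulL as b)) ⟩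
      (x · b) *F d ⊕ mulX (mulL as b) *F d     ≡⟨ cong₂ _⊕_ (·-* x b d) (*-mulXˡ _ d) ⟩
      x · (b *F d) ⊕ mulX (mulL as b *F d)     ≡⟨ cong (λ t → x · (b *F d) ⊕ mulX t) (go as) ⟩
      x · (b *F d) ⊕ mulX (mulL as (b *F d))   ∎

  *-lcomm : ∀ x y w → x *F (y *F w) ≡ y *F (x *F w)
  *-lcomm x y w = begin
    x *F (y *F w)  ≡⟨ sym (*-assoc x y w) ⟩
    (x *F y) *F w  ≡⟨ cong (_*F w) (*-comm x y) ⟩
    (y *F x) *F w  ≡⟨ *-assoc y x w ⟩
    y *F (x *F w)  ∎

  lam-* : ∀ y → lam *F y ≡ mulX y
  lam-* y = trans (*-comm lam y) (trans (*-mulXʳ y oneF) (cong mulX (*-oneʳ y)))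

  bit-* : ∀ x y → bitF x *F y ≡ x · y
  bit-* x y = trans (·-* x oneF y) (cong (x ·_) (*-oneˡ y))

  geometricSum : ∀ (g : ℕ → F (suc m)) → (∀ j → g (suc j) ≡ lam *F g j) → ∀ n (f : ℕ → Bool) →
    sumF (applyUpTo (λ j → bitF (f j) *F g j) n) ≡ g 0 *F mulL (applyUpTo f n) oneF
  geometricSum g step zero    f = sym (*-zeroʳ (g 0))
  geometricSum g step (suc n) f = begin
    bitF (f 0) *F g 0 ⊕ sumF (applyUpTo (λ j → bitF (f (suc j)) *F g (suc j)) n)
      ≡⟨ cong₂ _⊕_ (bit-* (f 0) (g 0)) (geometricSum (λ j → g (suc j)) (λ j → step (suc j)) n (λ j → f (suc j))) ⟩
    f 0 · g 0 ⊕ g 1 *F M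
      ≡⟨ cong (f 0 · g 0 ⊕_) (trans (cong (_*F M) (step 0)) (trans (*-assoc lam (g 0) M) (lam-* _))) ⟩
    f 0 · g 0 ⊕ mulX (g 0 *F M)
      ≡⟨ cong₂ _⊕_ (sym (trans (*-comm (g 0) (f 0 · oneF)) (bit-* (f 0) (g 0)))) (sym (*-mulXʳ (g 0) M)) ⟩
    g 0 *F (f 0 · oneF) ⊕ g 0 *F mulX M
      ≡⟨ sym (*-distribˡ (g 0) _ _) ⟩
    g 0 *F mulL (applyUpTo f (suc n)) oneF ∎
    where
    M = mulL (applyUpTo (λ j → f (suc j)) n) oneF

  scale2-one : ∀ u → scale2 oneF u ≡ u
  scale2-one (x , z) = cong₂ _,_ (*-oneˡ x) (*-oneˡ z)

  scale2-zero : ∀ u → scale2 zeroF u ≡ (zeroF , zeroF)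
  scale2-zero (x , z) = cong₂ _,_ (*-zeroˡ x) (*-zeroˡ z)

  scale2-scale2 : ∀ a b u → scale2 a (scale2 b u) ≡ scale2 (a *F b) u
  scale2-scale2 a b (x , z) = cong₂ _,_ (sym (*-assoc a b x)) (sym (*-assoc a b z))

  cross : ∀ a x y x' y' → (x , y) ≡ scale2 a (x' , y') → x *F y' ≡ x' *F y
  cross a x y x' y' e = begin
    x *F y'          ≡⟨ cong (_*F y') (cong proj₁ e) ⟩
    (a *F x') *F y'  ≡⟨ *-assoc a x' y' ⟩
    a *F (x' *F y')  ≡⟨ *-lcomm a x' y' ⟩
    x' *F (a *F y')  ≡⟨ cong (x' *F_) (sym (cong proj₂ e)) ⟩
    x' *F y          ∎

-- Consequences of λ being primitive for a modulus of degree n = m + 2: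
-- the constant coefficient of f is 1, F₂[x]/(f) has no zero divisors and
-- every nonzero element is invertible (so it is the field F_q), and
-- f(1) ≠ 0, i.e. the low coefficients of f have even parity.
module PrimitiveField (m : ℕ) (c₀ : Bool) (ct : Vec Bool (suc m))
                      (isPrimitive : Field.Primitive (c₀ ∷ ct)) where
  open Field (c₀ ∷ ct)
  open QuotientRing (c₀ ∷ ct)
  open Bits

  c : Vec Bool (suc (suc m))
  c = c₀ ∷ ct

  true≢false : true ≢ false
  true≢false ()

  lam≡ : lam ≡ false ∷ true ∷ 𝟘
  lam≡ = begin
    mulX oneF                        ≡⟨ mulX-shift oneF (last-𝟘 {m}) ⟩
    false ∷ true ∷ init (𝟘 {suc m})  ≡⟨ cong (λ t → false ∷ true ∷ t) (init-𝟘 {m}) ⟩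
    false ∷ true ∷ 𝟘                 ∎

  opl : F (suc (suc m))
  opl = oneF ⊕ lam

  opl≡ : opl ≡ true ∷ true ∷ 𝟘
  opl≡ = trans (cong (oneF ⊕_) lam≡) (cong (λ t → true ∷ true ∷ t) (⊕-identityˡ _))

  opl-* : ∀ y → opl *F y ≡ y ⊕ lam *F y
  opl-* y = trans (*-distribʳ y oneF lam) (cong (_⊕ lam *F y) (*-oneˡ y))

  one≢0 : oneF ≢ zeroF
  one≢0 e = true≢false (cong head e)

  lam≢0 : lam ≢ zeroF
  lam≢0 e = true≢false (cong (λ v → head (tail v)) (trans (sym lam≡) e))

  opl≢0 : opl ≢ zeroF
  opl≢0 e = true≢false (cong head (trans (sym opl≡) e))

  head-mulX : ∀ y → head (mulX y) ≡ (last y ∧ c₀)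
  head-mulX y with last y
  ... | false = refl
  ... | true  = refl

  -- 1 + λ is a power of λ only if f has constant term 1
  constant-term : c₀ ≡ true
  constant-term = bit-is-true c₀ refl
    where
    bit-is-true : ∀ b → b ≡ c₀ → b ≡ true
    bit-is-true true  _ = refl
    bit-is-true false e with isPrimitive opl opl≢0
    ... | zero  , p = ⊥-elim (true≢false (cong (λ v → head (tail v)) (trans (sym opl≡) (sym p))))
    ... | suc j , p = ⊥-elim (true≢false (begin
      true                          ≡⟨ cong head (sym opl≡) ⟩
      head opl                      ≡⟨ cong head (sym p) ⟩
      head (lam *F (lam ^F j))      ≡⟨ cong head (lam-* (lam ^F j)) ⟩
      head (mulX (lam ^F j))        ≡⟨ head-mulX (lam ^F j) ⟩
      last (lam ^F j) ∧ c₀          ≡⟨ cong (last (lam ^F j) ∧_) (sym e) ⟩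
      last (lam ^F j) ∧ false       ≡⟨ ∧-zeroʳ _ ⟩
      false                         ∎))

  mulX≡0 : ∀ w → mulX w ≡ zeroF → w ≡ zeroF
  mulX≡0 w e = init-last-ext w 𝟘 (trans init-w (sym (init-𝟘 {suc m}))) (trans last-w (sym (last-𝟘 {suc m})))
    where
    last-w : last w ≡ false
    last-w = top-bit (last w) (trans (sym (head-mulX w)) (cong head e))
      where
      top-bit : ∀ b → (b ∧ c₀) ≡ false → b ≡ false
      top-bit false _ = refl
      top-bit true  p = trans (sym constant-term) p
    init-w : init w ≡ 𝟘
    init-w = cong tail (trans (sym (mulX-shift w last-w)) e)

  lam-cancel : ∀ a b → lam *F a ≡ lam *F b → a ≡ b
  lam-cancel a b e = ⊕-cancel a b (mulX≡0 (a ⊕ b) (begin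
    mulX (a ⊕ b)             ≡⟨ sym (lam-* (a ⊕ b)) ⟩
    lam *F (a ⊕ b)           ≡⟨ *-distribˡ lam a b ⟩
    lam *F a ⊕ lam *F b      ≡⟨ cong (_⊕ lam *F b) e ⟩
    lam *F b ⊕ lam *F b      ≡⟨ ⊕-self _ ⟩
    zeroF                    ∎))

  -- F₂[x]/(f) is an integral domain: every nonzero element is a power of λ
  zero-divisor-free : ∀ a b → a ≢ zeroF → a *F b ≡ zeroF → b ≡ zeroF
  zero-divisor-free a b a≢0 e with isPrimitive a a≢0
  ... | j , p = pow-cancel j (trans (cong (_*F b) p) e)
    where
    pow-cancel : ∀ j → (lam ^F j) *F b ≡ zeroF → b ≡ zeroF
    pow-cancel zero    e = trans (sym (*-oneˡ b)) e
    pow-cancel (suc j) e = pow-cancel j (mulX≡0 _ (begin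
      mulX (lam ^F j *F b)      ≡⟨ sym (lam-* _) ⟩
      lam *F (lam ^F j *F b)    ≡⟨ sym (*-assoc lam (lam ^F j) b) ⟩
      (lam *F lam ^F j) *F b    ≡⟨ e ⟩
      zeroF                     ∎))

  *-nonzero : ∀ a b → a ≢ zeroF → b ≢ zeroF → a *F b ≢ zeroF
  *-nonzero a b a≢0 b≢0 e = b≢0 (zero-divisor-free a b a≢0 e)

  *-cancelˡ : ∀ a b d → a ≢ zeroF → a *F b ≡ a *F d → b ≡ d
  *-cancelˡ a b d a≢0 e = ⊕-cancel b d (zero-divisor-free a _ a≢0 (begin
    a *F (b ⊕ d)          ≡⟨ *-distribˡ a b d ⟩
    a *F b ⊕ a *F d       ≡⟨ cong (_⊕ a *F d) e ⟩
    a *F d ⊕ a *F d       ≡⟨ ⊕-self _ ⟩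
    zeroF                 ∎))

  -- the only element fixed by λ is 0, since 1 + λ is not a zero divisor
  lam-fixed : ∀ z → lam *F z ≡ z → z ≡ zeroF
  lam-fixed z e = zero-divisor-free opl z opl≢0 (trans (opl-* z) (trans (cong (z ⊕_) e) (⊕-self z)))

  -- λ⁻¹ = c₁ + c₂λ + … + λⁿ⁻¹, since λ·λ⁻¹ = f(λ) + c₀ = 1
  lam⁻¹ : F (suc (suc m))
  lam⁻¹ = ct ∷ʳ true

  lam-lam⁻¹ : lam *F lam⁻¹ ≡ oneF
  lam-lam⁻¹ = begin
    lam *F lam⁻¹                                  ≡⟨ lam-* lam⁻¹ ⟩
    (false ∷ init (ct ∷ʳ true)) ⊕ last (ct ∷ʳ true) · c
      ≡⟨ cong₂ (λ u w → (false ∷ u) ⊕ w · c) (init-∷ʳ true ct) (last-∷ʳ true ct) ⟩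
    (false ∷ ct) ⊕ (c₀ ∷ ct)                      ≡⟨ cong₂ _∷_ constant-term (⊕-self ct) ⟩
    oneF                                          ∎

  inverse : ∀ a → a ≢ zeroF → Σ (F (suc (suc m))) λ a⁻¹ → a *F a⁻¹ ≡ oneF
  inverse a a≢0 with isPrimitive a a≢0
  ... | j , p = lam⁻¹ ^F j , trans (cong (_*F lam⁻¹ ^F j) (sym p)) (pow-inv j)
    where
    pow-inv : ∀ j → lam ^F j *F lam⁻¹ ^F j ≡ oneF
    pow-inv zero    = *-oneˡ oneF
    pow-inv (suc j) = begin
      (lam *F lam ^F j) *F (lam⁻¹ *F lam⁻¹ ^F j)   ≡⟨ *-assoc lam _ _ ⟩
      lam *F (lam ^F j *F (lam⁻¹ *F lam⁻¹ ^F j))   ≡⟨ cong (lam *F_) (*-lcomm (lam ^F j) lam⁻¹ (lam⁻¹ ^F j)) ⟩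
      lam *F (lam⁻¹ *F (lam ^F j *F lam⁻¹ ^F j))   ≡⟨ sym (*-assoc lam lam⁻¹ _) ⟩
      (lam *F lam⁻¹) *F (lam ^F j *F lam⁻¹ ^F j)   ≡⟨ cong₂ _*F_ lam-lam⁻¹ (pow-inv j) ⟩
      oneF *F oneF                                 ≡⟨ *-oneˡ oneF ⟩
      oneF                                         ∎

  inverse≢0 : ∀ a b → a *F b ≡ oneF → b ≢ zeroF
  inverse≢0 a b inv b≡0 = one≢0 (trans (sym inv) (trans (cong (a *F_) b≡0) (*-zeroʳ a)))

  -- f(1) ≠ 0: otherwise the prefix sums G of the coefficients of f satisfy (1 + λ)G = 0
  parity-modulus : par c ≡ false
  parity-modulus with par c in e
  ... | false = refl
  ... | true  = ⊥-elim (G≢0 (zero-divisor-free opl G opl≢0 (begin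
    opl *F G                             ≡⟨ opl-* G ⟩
    G ⊕ lam *F G                         ≡⟨ cong (G ⊕_) (lam-* G) ⟩
    G ⊕ ((false ∷ init G) ⊕ last G · c)  ≡⟨ cong (λ b → G ⊕ ((false ∷ init G) ⊕ b · c)) last-G ⟩
    G ⊕ ((false ∷ init G) ⊕ c)           ≡⟨ sym (⊕-assoc G _ c) ⟩
    (G ⊕ init (false ∷ G)) ⊕ c           ≡⟨ cong (_⊕ c) (prefixSums-difference false c) ⟩
    c ⊕ c                                ≡⟨ ⊕-self c ⟩
    zeroF                                ∎)))
    where
    G = prefixSums false c
    last-G : last G ≡ true
    last-G = trans (last-prefixSums false c) e
    G≢0 : G ≢ zeroF
    G≢0 g = true≢false (trans (sym last-G) (trans (cong last g) (last-𝟘 {suc m})))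

  cross⁻¹ : ∀ x y x' y' → y ≢ zeroF → y' ≢ zeroF → x *F y' ≡ x' *F y → (x , y) ∼₂ (x' , y')
  cross⁻¹ x y x' y' y≢0 y'≢0 e with inverse y' y'≢0
  ... | y'⁻¹ , inv = y *F y'⁻¹ , *-nonzero y y'⁻¹ y≢0 (inverse≢0 y' y'⁻¹ inv) , cong₂ _,_ first second
    where
    first : x ≡ (y *F y'⁻¹) *F x'
    first = begin
      x                      ≡⟨ sym (*-oneʳ x) ⟩
      x *F oneF              ≡⟨ cong (x *F_) (sym inv) ⟩
      x *F (y' *F y'⁻¹)      ≡⟨ sym (*-assoc x y' y'⁻¹) ⟩
      (x *F y') *F y'⁻¹      ≡⟨ cong (_*F y'⁻¹) e ⟩
      (x' *F y) *F y'⁻¹      ≡⟨ *-assoc x' y y'⁻¹ ⟩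
      x' *F (y *F y'⁻¹)      ≡⟨ *-comm x' _ ⟩
      (y *F y'⁻¹) *F x'      ∎
    second : y ≡ (y *F y'⁻¹) *F y'
    second = begin
      y                      ≡⟨ sym (*-oneʳ y) ⟩
      y *F oneF              ≡⟨ cong (y *F_) (trans (sym inv) (*-comm y' y'⁻¹)) ⟩
      y *F (y'⁻¹ *F y')      ≡⟨ sym (*-assoc y y'⁻¹ y') ⟩
      (y *F y'⁻¹) *F y'      ∎

  inC-scale : ∀ a u → a ≢ zeroF → inC u → inC (scale2 a u)
  inC-scale a u a≢0 (s , s≢0 , b , b≢0 , e) =
    s , s≢0 , a *F b , *-nonzero a b a≢0 b≢0 , trans (cong (scale2 a) e) (scale2-scale2 a b (wvec s))

  inC-unscale : ∀ a u → a ≢ zeroF → inC (scale2 a u) → inC u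
  inC-unscale a u a≢0 m with inverse a a≢0
  ... | a⁻¹ , inv = subst inC back (inC-scale a⁻¹ (scale2 a u) (inverse≢0 a a⁻¹ inv) m)
    where
    back : scale2 a⁻¹ (scale2 a u) ≡ u
    back = trans (scale2-scale2 a⁻¹ a u) (trans (cong (λ t → scale2 t u) (trans (*-comm a⁻¹ a) inv)) (scale2-one u))

module Weights {h : ℕ} (c : Vec Bool h) where
  open Field c
  open Enumeration

  eqV2B-refl : ∀ u → eqV2B u u ≡ true
  eqV2B-refl (x , z) rewrite eqVB-refl x | eqVB-refl z = refl

  eqV2B-sound : ∀ u w → eqV2B u w ≡ true → u ≡ w
  eqV2B-sound (x , z) (x' , z') e with eqVB x x' in ex | eqVB z z' in ez
  ... | true | true = cong₂ _,_ (eqVB-sound x x' ex) (eqVB-sound z z' ez)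

  cardW∩-by : ∀ v (q : F h → Bool) → (∀ s → (∃ λ a → wvec s ≡ scale2 a v) ⇔ q s ≡ true) →
              cardW∩ v ≡ countL q (allVecs h)
  cardW∩-by v q spec = count-⇔ (allVecs h) (λ s → mk⇔
    (λ e → let (a , ea) = anyL-sound _ (allVecs h) e in
           Equivalence.to (spec s) (a , eqV2B-sound _ _ ea))
    (λ e → let (a , ea) = Equivalence.from (spec s) e in
           anyL-complete (λ a → eqV2B (wvec s) (scale2 a v)) a (subst (λ u → eqV2B (wvec s) u ≡ true) ea (eqV2B-refl (wvec s)))))

-- From now on h = k + 3, λ is primitive and the coefficient c_{h-1} of
-- the modulus vanishes.
module Construction (k : ℕ) (c₀ : Bool) (ct : Vec Bool (2 + k)) (top-coef : last ct ≡ false)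
                    (isPrimitive : Field.Primitive (c₀ ∷ ct)) where
  open Field (c₀ ∷ ct)
  open QuotientRing (c₀ ∷ ct)
  open PrimitiveField (suc k) c₀ ct isPrimitive
  open Bits
  open Padding

  -- Multiplication by λ shifts up; the overflow term (last y)·c changes
  -- neither the top coordinate (c_{h-1} = 0) nor the parity (f(1) ≠ 0).
  last-lam : ∀ y → last (lam *F y) ≡ penult y
  last-lam y = begin
    last (lam *F y)                            ≡⟨ cong last (lam-* y) ⟩
    last ((false ∷ init y) ⊕ last y · c)       ≡⟨ last-⊕ (false ∷ init y) (last y · c) ⟩
    penult y xor last (last y · c)             ≡⟨ cong (penult y xor_) (last-· (last y) c) ⟩
    penult y xor (last y ∧ last ct)            ≡⟨ cong (λ b → penult y xor (last y ∧ b)) top-coef ⟩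
    penult y xor (last y ∧ false)              ≡⟨ cong (penult y xor_) (∧-zeroʳ (last y)) ⟩
    penult y xor false                         ≡⟨ xor-identityʳ (penult y) ⟩
    penult y                                   ∎

  par-lam : ∀ y → par (lam *F y) ≡ par (init y)
  par-lam y = begin
    par (lam *F y)                             ≡⟨ cong par (lam-* y) ⟩
    par ((false ∷ init y) ⊕ last y · c)        ≡⟨ par-⊕ (false ∷ init y) (last y · c) ⟩
    par (init y) xor par (last y · c)          ≡⟨ cong (par (init y) xor_) (par-· (last y) c) ⟩
    par (init y) xor (last y ∧ par c)          ≡⟨ cong (λ b → par (init y) xor (last y ∧ b)) parity-modulus ⟩
    par (init y) xor (last y ∧ false)          ≡⟨ cong (par (init y) xor_) (∧-zeroʳ (last y)) ⟩
    par (init y) xor false                     ≡⟨ xor-identityʳ (par (init y)) ⟩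
    par (init y)                               ∎

  pair : Bool → Bool → F (3 + k)
  pair a b = a ∷ b ∷ 𝟘

  pair-sum : ∀ a b → bitF a +F bitF b *F lam ≡ pair a b
  pair-sum a b = trans (cong (bitF a ⊕_) (trans (bit-* b lam) (cong (b ·_) lam≡))) (by-cases a b)
    where
    by-cases : ∀ a b → bitF a ⊕ b · (false ∷ true ∷ 𝟘) ≡ pair a b
    by-cases false false = ⊕-identityˡ 𝟘
    by-cases false true  = ⊕-identityˡ _
    by-cases true  false = ⊕-identityʳ _
    by-cases true  true  = cong (λ t → true ∷ true ∷ t) (⊕-identityˡ 𝟘)

  pair-* : ∀ y a b → y *F pair a b ≡ a · y ⊕ b · (lam *F y)
  pair-* y a b = begin
    y *F pair a b                          ≡⟨ cong (y *F_) (sym (pair-sum a b)) ⟩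
    y *F (bitF a ⊕ bitF b *F lam)          ≡⟨ *-distribˡ y _ _ ⟩
    y *F bitF a ⊕ y *F (bitF b *F lam)     ≡⟨ cong₂ _⊕_ (trans (*-comm y _) (bit-* a y)) (*-lcomm y (bitF b) lam) ⟩
    a · y ⊕ bitF b *F (y *F lam)           ≡⟨ cong (a · y ⊕_) (trans (bit-* b _) (cong (b ·_) (*-comm y lam))) ⟩
    a · y ⊕ b · (lam *F y)                 ∎

  last-*pair : ∀ y a b → last (y *F pair a b) ≡ (a ∧ last y) xor (b ∧ penult y)
  last-*pair y a b = begin
    last (y *F pair a b)                          ≡⟨ cong last (pair-* y a b) ⟩
    last (a · y ⊕ b · (lam *F y))                 ≡⟨ last-⊕ (a · y) _ ⟩
    last (a · y) xor last (b · (lam *F y))        ≡⟨ cong₂ _xor_ (last-· a y) (last-· b (lam *F y)) ⟩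
    (a ∧ last y) xor (b ∧ last (lam *F y))        ≡⟨ cong (λ t → (a ∧ last y) xor (b ∧ t)) (last-lam y) ⟩
    (a ∧ last y) xor (b ∧ penult y)               ∎

  par-*pair : ∀ y a b → par (y *F pair a b) ≡ (a ∧ par y) xor (b ∧ par (init y))
  par-*pair y a b = begin
    par (y *F pair a b)                           ≡⟨ cong par (pair-* y a b) ⟩
    par (a · y ⊕ b · (lam *F y))                  ≡⟨ par-⊕ (a · y) _ ⟩
    par (a · y) xor par (b · (lam *F y))          ≡⟨ cong₂ _xor_ (par-· a y) (par-· b (lam *F y)) ⟩
    (a ∧ par y) xor (b ∧ par (lam *F y))          ≡⟨ cong (λ t → (a ∧ par y) xor (b ∧ t)) (par-lam y) ⟩
    (a ∧ par y) xor (b ∧ par (init y))            ∎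

  -- Normal form of the generating vectors: writing s = (s₀, …, s_{h-1}),
  --   w(s) = (λ · wx s , wz s),  wx s = s₀ + … + s_{h-2}λ^{h-2},  wz s = s_{h-2} + s_{h-1}λ.
  wx : F (3 + k) → F (3 + k)
  wx s = init s ∷ʳ false

  wz : F (3 + k) → F (3 + k)
  wz s = pair (penult s) (last s)

  wvec-nf : ∀ s → wvec s ≡ (lam *F wx s , wz s)
  wvec-nf s = cong₂ _,_ first (trans (cong₂ (λ u w → bitF u +F bitF w *F lam) (coef-penult s) (coef-last s))
                                     (pair-sum (penult s) (last s)))
    where
    first : sumF (map (λ j → bitF (coef s j) *F (lam ^F suc j)) (upTo (2 + k))) ≡ lam *F wx s
    first = begin
      sumF (map (λ j → bitF (coef s j) *F (lam ^F suc j)) (upTo (2 + k)))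
        ≡⟨ cong sumF (map-upTo (λ j → bitF (coef s j) *F (lam ^F suc j)) (2 + k)) ⟩
      sumF (applyUpTo (λ j → bitF (coef s j) *F (lam ^F suc j)) (2 + k))
        ≡⟨ geometricSum (λ j → lam ^F suc j) (λ j → refl) (2 + k) (coef s) ⟩
      (lam *F oneF) *F mulL (applyUpTo (coef s) (2 + k)) oneF
        ≡⟨ cong₂ (λ u w → u *F mulL w oneF) (*-oneʳ lam) (coefs-init s) ⟩
      lam *F mulL (toList (init s)) oneF
        ≡⟨ cong (lam *F_) (mulL-one (toList (init s)) (subst (_≤ 3 + k) (sym (length-toList (init s))) (m≤n⇒m≤1+n ≤-refl))) ⟩
      lam *F padL (toList (init s)) (3 + k)
        ≡⟨ cong (lam *F_) (padL-toList-∷ʳ (init s)) ⟩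
      lam *F wx s ∎

  init-wx : ∀ s → init (wx s) ≡ init s
  init-wx s = init-∷ʳ false (init s)

  last-wx : ∀ s → last (wx s) ≡ false
  last-wx s = last-∷ʳ false (init s)

  penult-wx : ∀ s → penult (wx s) ≡ last (init s)
  penult-wx s = cong last (init-wx s)

  last-wx*wz : ∀ t u → last (wx t *F wz u) ≡ (last u ∧ penult t)
  last-wx*wz t u = begin
    last (wx t *F wz u)                                   ≡⟨ last-*pair (wx t) (penult u) (last u) ⟩
    (penult u ∧ last (wx t)) xor (last u ∧ penult (wx t)) ≡⟨ cong₂ (λ x y → (penult u ∧ x) xor (last u ∧ y)) (last-wx t) (penult-wx t) ⟩
    (penult u ∧ false) xor (last u ∧ penult t)            ≡⟨ cong (_xor (last u ∧ penult t)) (∧-zeroʳ (penult u)) ⟩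
    last u ∧ penult t                                     ∎

  wx-top0 : ∀ s → last s ≡ false → wx s ≡ s
  wx-top0 s e = init-last-ext (wx s) s (init-wx s) (trans (last-wx s) (sym e))

  wz≡0 : ∀ s → wz s ≡ 𝟘 → penult s ≡ false × last s ≡ false
  wz≡0 s e = cong head e , cong (λ v → head (tail v)) e

  wz-𝟘 : wz 𝟘 ≡ 𝟘
  wz-𝟘 = cong₂ pair (trans (cong last (init-𝟘 {1 + k})) (last-𝟘 {k})) (last-𝟘 {1 + k})

  rank : RankH
  rank s e = init-last-ext s 𝟘 (trans (sym (init-wx s)) (cong init wx≡0))
                               (trans (proj₂ (wz≡0 s wz≡𝟘)) (sym (last-𝟘 {2 + k})))
    where
    wx≡0 : wx s ≡ 𝟘
    wx≡0 = zero-divisor-free lam (wx s) lam≢0 (trans (sym (cong proj₁ (wvec-nf s))) (cong proj₁ e))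
    wz≡𝟘 : wz s ≡ 𝟘
    wz≡𝟘 = trans (sym (cong proj₂ (wvec-nf s))) (cong proj₂ e)

  -- The head ⟨(λ, 0)⟩ = ⟨w(1)⟩ of the club: w(s) lies on it exactly when
  -- wz s = 0, i.e. s_{h-2} = s_{h-1} = 0, giving weight h - 2.
  v₀ : V2
  v₀ = (lam , zeroF)

  wvec-onHead : ∀ s → wz s ≡ 𝟘 → wvec s ≡ scale2 s v₀
  wvec-onHead s e = trans (wvec-nf s) (cong₂ _,_
    (trans (cong (lam *F_) (wx-top0 s (proj₂ (wz≡0 s e)))) (*-comm lam s))
    (trans e (sym (*-zeroʳ s))))

  wz-one : wz oneF ≡ 𝟘
  wz-one = cong₂ pair (trans (cong last (init-𝟘 {1 + k})) (last-𝟘 {k})) (last-𝟘 {1 + k})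

  v₀∈𝒞 : inC v₀
  v₀∈𝒞 = oneF , one≢0 , oneF , one≢0 ,
         sym (trans (scale2-one (wvec oneF)) (trans (wvec-onHead oneF wz-one) (scale2-one v₀)))

  wz-bits : ∀ s → wz s ≡ 𝟘 ⇔ Enumeration.lastTwoZero s ≡ true
  wz-bits s = mk⇔ (λ e → let (p , l) = wz≡0 s e in cong₂ (λ a b → not a ∧ not b) p l)
                  (bits (penult s) (last s))
    where
    bits : ∀ a b → (not a ∧ not b) ≡ true → pair a b ≡ 𝟘
    bits false false _ = refl

  head-line : ∀ s → (∃ λ a → wvec s ≡ scale2 a v₀) ⇔ Enumeration.lastTwoZero s ≡ true
  head-line s = mk⇔
    (λ (a , e) → Equivalence.to (wz-bits s)
       (trans (sym (cong proj₂ (wvec-nf s))) (trans (cong proj₂ e) (*-zeroʳ a))))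
    (λ q → s , wvec-onHead s (Equivalence.from (wz-bits s) q))

  head-weight : cardW∩ v₀ ≡ 2 ^ suc k
  head-weight = trans (Weights.cardW∩-by (c₀ ∷ ct) v₀ Enumeration.lastTwoZero head-line)
                      (Enumeration.count-lastTwoZero (suc k))

  pair-determined : ∀ a b a' b' → pair a b ≢ 𝟘 → pair a' b' ≢ 𝟘 → (b ∧ a') ≡ (b' ∧ a) → pair a b ≡ pair a' b'
  pair-determined false false _     _     nz _   _ = ⊥-elim (nz refl)
  pair-determined _     _     false false _  nz' _ = ⊥-elim (nz' refl)
  pair-determined false true  false true  _  _   _ = refl
  pair-determined true  false true  false _  _   _ = refl
  pair-determined true  true  true  true  _  _   _ = refl
  pair-determined false true  true  false _  _   ()
  pair-determined false true  true  true  _  _   ()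
  pair-determined true  false false true  _  _   ()
  pair-determined true  false true  true  _  _   ()
  pair-determined true  true  false true  _  _   ()
  pair-determined true  true  true  false _  _   ()

  projective-injective : ∀ s s' b → wz s ≢ 𝟘 → b ≢ zeroF → wvec s' ≡ scale2 b (wvec s) → s' ≡ s
  projective-injective s s' b wz≢0 b≢0 e =
    init-last-ext s' s (trans (sym (init-wx s')) (trans (cong init wx-equal) (init-wx s)))
                       (cong (λ v → head (tail v)) (sym wz-equal))
    where
    e-nf : (lam *F wx s' , wz s') ≡ scale2 b (lam *F wx s , wz s)
    e-nf = trans (sym (wvec-nf s')) (trans e (cong (scale2 b) (wvec-nf s)))
    wz'≢0 : wz s' ≢ 𝟘
    wz'≢0 z = *-nonzero b (wz s) b≢0 wz≢0 (trans (sym (cong proj₂ e-nf)) z)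
    crossed : wx s' *F wz s ≡ wx s *F wz s'
    crossed = lam-cancel _ _ (begin
      lam *F (wx s' *F wz s)      ≡⟨ sym (*-assoc lam (wx s') (wz s)) ⟩
      (lam *F wx s') *F wz s      ≡⟨ cross b _ _ _ _ e-nf ⟩
      (lam *F wx s) *F wz s'      ≡⟨ *-assoc lam (wx s) (wz s') ⟩
      lam *F (wx s *F wz s')      ∎)
    wz-equal : wz s ≡ wz s'
    wz-equal = pair-determined _ _ _ _ wz≢0 wz'≢0 (begin
      last s ∧ penult s'      ≡⟨ sym (last-wx*wz s' s) ⟩
      last (wx s' *F wz s)    ≡⟨ cong last crossed ⟩
      last (wx s *F wz s')    ≡⟨ last-wx*wz s s' ⟩
      last s' ∧ penult s      ∎)
    wx-equal : wx s' ≡ wx s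
    wx-equal = *-cancelˡ (wz s) _ _ wz≢0 (begin
      wz s *F wx s'    ≡⟨ *-comm (wz s) (wx s') ⟩
      wx s' *F wz s    ≡⟨ crossed ⟩
      wx s *F wz s'    ≡⟨ cong (wx s *F_) (sym wz-equal) ⟩
      wx s *F wz s     ≡⟨ *-comm (wx s) (wz s) ⟩
      wz s *F wx s     ∎)

  wvec-𝟘 : wvec 𝟘 ≡ (zeroF , zeroF)
  wvec-𝟘 = trans (wvec-nf 𝟘) (cong₂ _,_ (trans (cong (lam *F_) (wx-top0 𝟘 (last-𝟘 {2 + k}))) (*-zeroʳ lam)) wz-𝟘)

  -- every other point ⟨a·w(s)⟩ of 𝒞 has wz s ≠ 0, so W ∩ ⟨v⟩ = {w(0), w(s)}
  other-weight : ∀ v → NonZero2 v → inC v → ¬ (v ∼₂ v₀) → cardW∩ v ≡ 2 ^ 1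
  other-weight v _ (s , s≢0 , a , a≢0 , ev) v≁v₀ =
    trans (Weights.cardW∩-by (c₀ ∷ ct) v (λ s' → eqVB s' 𝟘 ∨ eqVB s' s) on-line)
          (count-pair 𝟘 s (λ e → s≢0 (sym e)))
    where
    open Enumeration
    wz≢0 : wz s ≢ 𝟘
    wz≢0 z = v≁v₀ (a *F s , *-nonzero a s a≢0 s≢0 ,
                   trans ev (trans (cong (scale2 a) (wvec-onHead s z)) (scale2-scale2 a s v₀)))
    on-line : ∀ s' → (∃ λ b → wvec s' ≡ scale2 b v) ⇔ (eqVB s' 𝟘 ∨ eqVB s' s) ≡ true
    on-line s' = mk⇔ to from
      where
      via-s : ∀ b → wvec s' ≡ scale2 b v → wvec s' ≡ scale2 (b *F a) (wvec s)
      via-s b e = trans e (trans (cong (scale2 b) ev) (scale2-scale2 b a (wvec s)))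
      to : (∃ λ b → wvec s' ≡ scale2 b v) → (eqVB s' 𝟘 ∨ eqVB s' s) ≡ true
      to (b , e) with ≡-dec _≟B_ (b *F a) zeroF
      ... | yes ba≡0 = ∨-introˡ _ (eqVB-complete (rank s' (begin
        wvec s'                    ≡⟨ via-s b e ⟩
        scale2 (b *F a) (wvec s)   ≡⟨ cong (λ t → scale2 t (wvec s)) ba≡0 ⟩
        scale2 zeroF (wvec s)      ≡⟨ scale2-zero (wvec s) ⟩
        (zeroF , zeroF)            ∎)))
      ... | no ba≢0 = ∨-introʳ _ (eqVB-complete (projective-injective s s' (b *F a) wz≢0 ba≢0 (via-s b e)))
      from : (eqVB s' 𝟘 ∨ eqVB s' s) ≡ true → ∃ λ b → wvec s' ≡ scale2 b v
      from q with ∨-elim {eqVB s' 𝟘} q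
      ... | inj₁ q₀ = zeroF , (begin
        wvec s'           ≡⟨ cong wvec (eqVB-sound s' 𝟘 q₀) ⟩
        wvec 𝟘            ≡⟨ wvec-𝟘 ⟩
        (zeroF , zeroF)   ≡⟨ sym (scale2-zero v) ⟩
        scale2 zeroF v    ∎)
      ... | inj₂ q₁ with inverse a a≢0
      ... | a⁻¹ , inv = a⁻¹ , (begin
        wvec s'                          ≡⟨ cong wvec (eqVB-sound s' s q₁) ⟩
        wvec s                           ≡⟨ sym (scale2-one (wvec s)) ⟩
        scale2 oneF (wvec s)             ≡⟨ cong (λ t → scale2 t (wvec s)) (trans (sym inv) (*-comm a a⁻¹)) ⟩
        scale2 (a⁻¹ *F a) (wvec s)       ≡⟨ sym (scale2-scale2 a⁻¹ a (wvec s)) ⟩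
        scale2 a⁻¹ (scale2 a (wvec s))   ≡⟨ cong (scale2 a⁻¹) (sym ev) ⟩
        scale2 a⁻¹ v                     ∎)

  club : Club (suc k)
  club = v₀ , (λ e → lam≢0 (cong proj₁ e)) , v₀∈𝒞 , head-weight , other-weight

  -- The linear set viewed from the line ℓ: for ν ∈ F_q the point
  -- ⟨(λν, 1 + λ)⟩ lies in 𝒞 iff ν·(a + bλ) = (1 + λ)·wx s for some s with
  -- wz s = a + bλ ≠ 0, and this fails exactly for the "degenerate" ν.
  Solvable : F (3 + k) → Set
  Solvable ν = Σ (F (3 + k)) λ s → wz s ≢ 𝟘 × ν *F wz s ≡ opl *F wx s

  Degenerate : F (3 + k) → Set
  Degenerate ν = last ν ≡ penult ν × par (init (init ν)) ≡ true

  last-opl-wx : ∀ s → last (opl *F wx s) ≡ penult s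
  last-opl-wx s = begin
    last (opl *F wx s)                                ≡⟨ cong last (trans (*-comm opl (wx s)) (cong (wx s *F_) opl≡)) ⟩
    last (wx s *F pair true true)                     ≡⟨ last-*pair (wx s) true true ⟩
    last (wx s) xor penult (wx s)                     ≡⟨ cong₂ _xor_ (last-wx s) (penult-wx s) ⟩
    penult s                                          ∎

  par-opl-wx : ∀ s → par (opl *F wx s) ≡ false
  par-opl-wx s = begin
    par (opl *F wx s)                                 ≡⟨ cong par (trans (*-comm opl (wx s)) (cong (wx s *F_) opl≡)) ⟩
    par (wx s *F pair true true)                      ≡⟨ par-*pair (wx s) true true ⟩
    par (wx s) xor par (init (wx s))                  ≡⟨ cong (_xor par (init (wx s))) (par-init (wx s)) ⟩
    (par (init (wx s)) xor last (wx s)) xor par (init (wx s))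
                                                      ≡⟨ cong (λ b → (par (init (wx s)) xor b) xor par (init (wx s))) (last-wx s) ⟩
    (par (init (wx s)) xor false) xor par (init (wx s)) ≡⟨ xor-cancel (par (init (wx s))) false ⟩
    false                                             ∎

  -- a degenerate ν admits no solution: comparing the last coordinate and
  -- the parity of both sides forces wz s = 0
  unsolvable : ∀ ν s → Degenerate ν → ν *F wz s ≡ opl *F wx s → wz s ≡ 𝟘
  unsolvable ν s (last≡penult , par-low) eq = cong₂ pair (proj₁ zero-bits) (proj₂ zero-bits)
    where
    a = penult s
    b = last s
    e = penult ν
    par-init-ν : par (init ν) ≡ true xor e
    par-init-ν = trans (par-init (init ν)) (cong (_xor e) par-low)
    par-ν : par ν ≡ (true xor e) xor e
    par-ν = trans (par-init ν) (cong₂ _xor_ par-init-ν last≡penult)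
    on-last : (a ∧ e) xor (b ∧ e) ≡ a
    on-last = begin
      (a ∧ e) xor (b ∧ e)                 ≡⟨ cong (λ t → (a ∧ t) xor (b ∧ e)) (sym last≡penult) ⟩
      (a ∧ last ν) xor (b ∧ penult ν)     ≡⟨ sym (last-*pair ν a b) ⟩
      last (ν *F wz s)                    ≡⟨ cong last eq ⟩
      last (opl *F wx s)                  ≡⟨ last-opl-wx s ⟩
      a                                   ∎
    on-parity : (a ∧ ((true xor e) xor e)) xor (b ∧ (true xor e)) ≡ false
    on-parity = begin
      (a ∧ ((true xor e) xor e)) xor (b ∧ (true xor e))   ≡⟨ cong₂ (λ u w → (a ∧ u) xor (b ∧ w)) (sym par-ν) (sym par-init-ν) ⟩
      (a ∧ par ν) xor (b ∧ par (init ν))                  ≡⟨ sym (par-*pair ν a b) ⟩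
      par (ν *F wz s)                                     ≡⟨ cong par eq ⟩
      par (opl *F wx s)                                   ≡⟨ par-opl-wx s ⟩
      false                                               ∎
    bits : ∀ a b e → (a ∧ e) xor (b ∧ e) ≡ a → (a ∧ ((true xor e) xor e)) xor (b ∧ (true xor e)) ≡ false →
           a ≡ false × b ≡ false
    bits false false _     _  _  = refl , refl
    bits false true  false _  ()
    bits false true  true  () _
    bits true  false false () _
    bits true  true  false () _
    bits true  false true  _  ()
    bits true  true  true  () _
    zero-bits : a ≡ false × b ≡ false
    zero-bits = bits a b e on-last on-parity

  -- every G with top coordinate 0 is wx of s = (G₀, …, G_{h-2}, t)
  solution : ∀ ν G t → last G ≡ false → ν *F pair (penult G) t ≡ opl *F G → pair (penult G) t ≢ 𝟘 → Solvable ν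
  solution ν G t top eq nz = s , (λ z → nz (trans (sym wz-s) z)) , trans (cong (ν *F_) wz-s) (trans eq (cong (opl *F_) (sym wx-s)))
    where
    s = init G ∷ʳ t
    wx-s : wx s ≡ G
    wx-s = init-last-ext (wx s) G (trans (init-wx s) (init-∷ʳ t (init G))) (trans (last-wx s) (sym top))
    wz-s : wz s ≡ pair (penult G) t
    wz-s = cong₂ pair (cong last (init-∷ʳ t (init G))) (last-∷ʳ t (init G))

  last-prefixSums-even : ∀ (R : F (3 + k)) → par R ≡ false → last (prefixSums false R) ≡ false
  last-prefixSums-even R even = trans (last-prefixSums false R) even

  opl-prefixSums : ∀ (R : F (3 + k)) → par R ≡ false → opl *F prefixSums false R ≡ R
  opl-prefixSums R even = begin
    opl *F G                   ≡⟨ opl-* G ⟩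
    G ⊕ lam *F G               ≡⟨ cong (G ⊕_) (trans (lam-* G) (mulX-shift G (last-prefixSums-even R even))) ⟩
    G ⊕ init (false ∷ G)       ≡⟨ prefixSums-difference false R ⟩
    R                          ∎
    where
    G = prefixSums false R

  nonzero-second : ∀ a → pair a true ≢ 𝟘
  nonzero-second a z = true≢false (cong (λ v → head (tail v)) z)

  -- ν = … + λ^{h-2} (top coordinate 0): take wx s = ν, wz s = 1 + λ
  solvable-top : ∀ ν → last ν ≡ false → penult ν ≡ true → Solvable ν
  solvable-top ν top pen = solution ν ν true top
    (trans (cong (λ b → ν *F pair b true) pen) (trans (cong (ν *F_) (sym opl≡)) (*-comm ν opl)))
    (nonzero-second (penult ν))

  -- ν of even parity with par (init ν) = 1: take wz s = 1, wx s the prefix sums of ν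
  solvable-even : ∀ ν → par ν ≡ false → par (init ν) ≡ true → Solvable ν
  solvable-even ν even odd-init = solution ν G false (last-prefixSums-even ν even)
    (trans (cong (λ b → ν *F pair b false) pen-G) (trans (*-oneʳ ν) (sym (opl-prefixSums ν even))))
    (λ z → true≢false (trans (sym pen-G) (cong head z)))
    where
    G = prefixSums false ν
    pen-G : penult G ≡ true
    pen-G = trans (cong last (init-prefixSums false ν)) (trans (last-prefixSums false (init ν)) odd-init)

  -- ν with penult ν = 0 and par (init ν) = 0: take wz s = λ, wx s the prefix sums of λν
  solvable-shift : ∀ ν → penult ν ≡ false → par (init ν) ≡ false → Solvable ν
  solvable-shift ν pen even-init = solution ν G true (last-prefixSums-even R even-R)
    (trans (cong (λ b → ν *F pair b true) pen-G)
      (trans (cong (ν *F_) (sym lam≡)) (trans (*-comm ν lam) (sym (opl-prefixSums R even-R)))))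
    (nonzero-second (penult G))
    where
    R = lam *F ν
    even-R : par R ≡ false
    even-R = trans (par-lam ν) even-init
    pen-G : penult (prefixSums false R) ≡ false
    pen-G = begin
      penult (prefixSums false R)          ≡⟨ cong last (init-prefixSums false R) ⟩
      last (prefixSums false (init R))     ≡⟨ last-prefixSums false (init R) ⟩
      par (init R)                         ≡⟨ sym (xor-identityʳ (par (init R))) ⟩
      par (init R) xor false               ≡⟨ cong (par (init R) xor_) (sym (trans (last-lam ν) pen)) ⟩
      par (init R) xor last R              ≡⟨ sym (par-init R) ⟩
      par R                                ≡⟨ even-R ⟩
      false                                ∎
    G = prefixSums false R

  par-init-ν : ∀ (ν : F (3 + k)) {x y} → par (init (init ν)) ≡ x → penult ν ≡ y → par (init ν) ≡ x xor y
  par-init-ν ν qx py = trans (par-init (init ν)) (cong₂ _xor_ qx py)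

  solvable : ∀ ν → ¬ Degenerate ν → Solvable ν
  solvable ν nd with last ν in l | penult ν in p | par (init (init ν)) in q
  ... | false | true  | _     = solvable-top ν l p
  ... | false | false | false = solvable-shift ν p (par-init-ν ν q p)
  ... | true  | false | false = solvable-shift ν p (par-init-ν ν q p)
  ... | true  | false | true  = solvable-even ν (trans (par-init ν) (cong₂ _xor_ (par-init-ν ν q p) l)) (par-init-ν ν q p)
  ... | true  | true  | false = solvable-even ν (trans (par-init ν) (cong₂ _xor_ (par-init-ν ν q p) l)) (par-init-ν ν q p)
  ... | false | false | true  = ⊥-elim (nd (refl , refl))
  ... | true  | true  | true  = ⊥-elim (nd (refl , refl))

  -- inC ⟨(λν, 1+λ)⟩ ⇔ Solvable ν, by cross-multiplying with w(s) = (λ·wx s, wz s)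
  inC⇔solvable : ∀ ν → inC (lam *F ν , opl) ⇔ Solvable ν
  inC⇔solvable ν = mk⇔ to from
    where
    to : inC (lam *F ν , opl) → Solvable ν
    to (s , _ , a , _ , e) = s , wz≢0 , sym (lam-cancel _ _ (begin
      lam *F (opl *F wx s)          ≡⟨ *-lcomm lam opl (wx s) ⟩
      opl *F (lam *F wx s)          ≡⟨ *-comm opl _ ⟩
      (lam *F wx s) *F opl          ≡⟨ sym (cross a _ _ _ _ e-nf) ⟩
      (lam *F ν) *F wz s            ≡⟨ *-assoc lam ν (wz s) ⟩
      lam *F (ν *F wz s)            ∎))
      where
      e-nf : (lam *F ν , opl) ≡ scale2 a (lam *F wx s , wz s)
      e-nf = trans e (cong (scale2 a) (wvec-nf s))
      wz≢0 : wz s ≢ 𝟘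
      wz≢0 z = opl≢0 (trans (cong proj₂ e-nf) (trans (cong (a *F_) z) (*-zeroʳ a)))
    from : Solvable ν → inC (lam *F ν , opl)
    from (s , wz≢0 , eq) = s , s≢0 , subst ((lam *F ν , opl) ∼₂_) (sym (wvec-nf s))
      (cross⁻¹ _ _ _ _ opl≢0 wz≢0 (begin
        (lam *F ν) *F wz s            ≡⟨ *-assoc lam ν (wz s) ⟩
        lam *F (ν *F wz s)            ≡⟨ cong (lam *F_) eq ⟩
        lam *F (opl *F wx s)          ≡⟨ *-lcomm lam opl (wx s) ⟩
        opl *F (lam *F wx s)          ≡⟨ *-comm opl _ ⟩
        (lam *F wx s) *F opl          ∎))
      where
      s≢0 : s ≢ 𝟘
      s≢0 s≡0 = wz≢0 (trans (cong wz s≡0) wz-𝟘)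

  -- U = 1 + λ^{h-2}: translating by U turns the defining conditions of
  -- S_{D,0} into degeneracy
  U : F (3 + k)
  U = (true ∷ 𝟘 {k}) ∷ʳ true ∷ʳ false

  last-U : last U ≡ false
  last-U = last-∷ʳ false ((true ∷ 𝟘 {k}) ∷ʳ true)

  penult-U : penult U ≡ true
  penult-U = trans (cong last (init-∷ʳ false ((true ∷ 𝟘 {k}) ∷ʳ true))) (last-∷ʳ true (true ∷ 𝟘 {k}))

  par-U : par (init (init U)) ≡ true
  par-U = begin
    par (init (init U))            ≡⟨ cong (λ t → par (init t)) (init-∷ʳ false ((true ∷ 𝟘 {k}) ∷ʳ true)) ⟩
    par (init ((true ∷ 𝟘 {k}) ∷ʳ true)) ≡⟨ cong par (init-∷ʳ true (true ∷ 𝟘 {k})) ⟩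
    true xor par (𝟘 {k})           ≡⟨ cong (true xor_) (par-𝟘 {k}) ⟩
    true                           ∎

  DCond : F (3 + k) → Set
  DCond μ = (coef μ (2 + k) xor coef μ (1 + k)) ≡ true × parity (map (coef μ) (upTo (1 + k))) ≡ false

  DCond⇔degenerate : ∀ μ → DCond μ ⇔ Degenerate (μ ⊕ U)
  DCond⇔degenerate μ
    rewrite coef-last μ | coef-penult μ | parity-coefs μ
          | last-⊕ μ U | penult-⊕ μ U | init-⊕ μ U | init-⊕ (init μ) (init U) | par-⊕ (init (init μ)) (init (init U))
          | last-U | penult-U | par-U
    = mk⇔ (to (last μ) (penult μ) (par (init (init μ)))) (from (last μ) (penult μ) (par (init (init μ))))
    where
    to : ∀ x y p → (x xor y) ≡ true × p ≡ false → (x xor false) ≡ (y xor true) × (p xor true) ≡ true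
    to false true  false _        = refl , refl
    to true  false false _        = refl , refl
    to false false _     (() , _)
    to true  true  _     (() , _)
    to _     _     true  (_ , ())
    from : ∀ x y p → (x xor false) ≡ (y xor true) × (p xor true) ≡ true → (x xor y) ≡ true × p ≡ false
    from false true  false _        = refl , refl
    from true  false false _        = refl , refl
    from false false _     (() , _)
    from true  true  _     (() , _)
    from _     _     true  (_ , ())

  solvable⇔¬DCond : ∀ μ → Solvable (μ ⊕ U) ⇔ (¬ DCond μ)
  solvable⇔¬DCond μ = mk⇔
    (λ (s , wz≢0 , eq) d → wz≢0 (unsolvable (μ ⊕ U) s (Equivalence.to (DCond⇔degenerate μ) d) eq))
    (λ nd → solvable (μ ⊕ U) (λ deg → nd (Equivalence.from (DCond⇔degenerate μ) deg)))

  X-coord : ∀ {u v : V3} → u ≡ v → proj₁ u ≡ proj₁ v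
  X-coord = cong proj₁

  Y-coord : ∀ {u v : V3} → u ≡ v → proj₁ (proj₂ u) ≡ proj₁ (proj₂ v)
  Y-coord = cong (λ t → proj₁ (proj₂ t))

  Z-coord : ∀ {u v : V3} → u ≡ v → proj₂ (proj₂ u) ≡ proj₂ (proj₂ v)
  Z-coord = cong (λ t → proj₂ (proj₂ t))

  -- Among the affine points (zμ, λz, z) of ℓ only S_{D,0} contributes:
  -- S_A lies on Z = 0, S_B on Y = 0, S_{C,0} on Y = Z and S_{E,0} on Y = λ²Z.
  A0-on-ℓ : ∀ z μ → z ≢ zeroF → A0 (z *F μ , lam *F z , z) → DCond μ
  A0-on-ℓ z μ z≢0 (inj₁ (_ , _ , _ , a , _ , e)) =
    ⊥-elim (z≢0 (trans (Z-coord e) (*-zeroʳ a)))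
  A0-on-ℓ z μ z≢0 (inj₂ (inj₁ (_ , _ , _ , a , _ , e))) =
    ⊥-elim (z≢0 (zero-divisor-free lam z lam≢0 (trans (Y-coord e) (*-zeroʳ a))))
  A0-on-ℓ z μ z≢0 (inj₂ (inj₂ (inj₁ (_ , _ , _ , a , _ , e)))) =
    ⊥-elim (z≢0 (lam-fixed z (trans (Y-coord e) (sym (Z-coord e)))))
  A0-on-ℓ z μ z≢0 (inj₂ (inj₂ (inj₂ (inj₁ (μ' , d₁ , d₂ , a , _ , e))))) =
    subst DCond (sym (*-cancelˡ z μ μ' z≢0 (trans (X-coord e) (cong (_*F μ') (sym z≡a))))) (d₁ , d₂)
    where
    z≡a : z ≡ a
    z≡a = trans (Z-coord e) (*-oneʳ a)
  A0-on-ℓ z μ z≢0 (inj₂ (inj₂ (inj₂ (inj₂ (_ , _ , _ , a , _ , e))))) =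
    ⊥-elim (z≢0 (lam-fixed z (sym (lam-cancel z (lam *F z) (begin
      lam *F z                     ≡⟨ Y-coord e ⟩
      a *F (lam *F (lam *F oneF))  ≡⟨ cong (λ t → a *F (lam *F t)) (*-oneʳ lam) ⟩
      a *F (lam *F lam)            ≡⟨ *-lcomm a lam lam ⟩
      lam *F (a *F lam)            ≡⟨ cong (lam *F_) (*-comm a lam) ⟩
      lam *F (lam *F a)            ≡⟨ cong (λ t → lam *F (lam *F t)) (sym z≡a) ⟩
      lam *F (lam *F z)            ∎)))))
    where
    z≡a : z ≡ a
    z≡a = trans (Z-coord e) (*-oneʳ a)

  T⇔¬DCond : ∀ z μ → z ≢ zeroF → T (z *F μ , z) ⇔ (¬ DCond μ)
  T⇔¬DCond z μ z≢0 = mk⇔ to (λ nd → inj₂ (refl , λ a₀ → nd (A0-on-ℓ z μ z≢0 a₀)))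
    where
    to : T (z *F μ , z) → ¬ DCond μ
    to (inj₁ (a , _ , e))  _ = z≢0 (trans (Z-coord e) (*-zeroʳ a))
    to (inj₂ (_ , ∉𝒜₀)) d = ∉𝒜₀ (inj₂ (inj₂ (inj₂ (inj₁
      (μ , proj₁ d , proj₂ d , z , z≢0 , cong₂ _,_ refl (cong₂ _,_ (*-comm lam z) (sym (*-oneʳ z))))))))

  M : V2 → V2
  M = act lam (lam *F U) zeroF opl

  det≢0 : det lam (lam *F U) zeroF opl ≢ zeroF
  det≢0 e = *-nonzero lam opl lam≢0 opl≢0 (begin
    lam *F opl                                ≡⟨ sym (⊕-identityʳ _) ⟩
    lam *F opl ⊕ zeroF                        ≡⟨ cong (lam *F opl ⊕_) (sym (*-zeroʳ (lam *F U))) ⟩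
    lam *F opl ⊕ (lam *F U) *F zeroF          ≡⟨ e ⟩
    zeroF                                     ∎)

  M-affine : ∀ z μ → M (z *F μ , z) ≡ scale2 z (lam *F (μ ⊕ U) , opl)
  M-affine z μ = cong₂ _,_ (begin
      lam *F (z *F μ) ⊕ (lam *F U) *F z       ≡⟨ cong₂ _⊕_ (*-lcomm lam z μ) (*-comm (lam *F U) z) ⟩
      z *F (lam *F μ) ⊕ z *F (lam *F U)       ≡⟨ sym (*-distribˡ z _ _) ⟩
      z *F (lam *F μ ⊕ lam *F U)              ≡⟨ cong (z *F_) (sym (*-distribˡ lam μ U)) ⟩
      z *F (lam *F (μ ⊕ U))                   ∎)
    (begin
      zeroF *F (z *F μ) ⊕ opl *F z            ≡⟨ cong (_⊕ opl *F z) (*-zeroˡ _) ⟩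
      zeroF ⊕ opl *F z                        ≡⟨ ⊕-identityˡ _ ⟩
      opl *F z                                ≡⟨ *-comm opl z ⟩
      z *F opl                                ∎)

  M-∞ : ∀ x → M (x , zeroF) ≡ scale2 x v₀
  M-∞ x = cong₂ _,_
    (trans (cong (lam *F x ⊕_) (*-zeroʳ (lam *F U))) (trans (⊕-identityʳ _) (*-comm lam x)))
    (trans (cong₂ _⊕_ (*-zeroˡ x) (*-zeroʳ opl)) (trans (⊕-identityʳ _) (sym (*-zeroʳ x))))

  -- points at infinity: ⟨(x, 0)⟩ is N on one side and the head on the other
  correspondence-∞ : ∀ x → x ≢ zeroF → T (x , zeroF) ⇔ inC (M (x , zeroF))
  correspondence-∞ x x≢0 = mk⇔
    (λ _ → subst inC (sym (M-∞ x)) (inC-scale x v₀ x≢0 v₀∈𝒞))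
    (λ _ → inj₁ (x , x≢0 , cong₂ _,_ (sym (*-oneʳ x)) (cong₂ _,_ (trans (*-zeroʳ lam) (sym (*-zeroʳ x))) (sym (*-zeroʳ x)))))

  -- affine points: T(zμ, z) ⇔ ¬DCond μ ⇔ Solvable (μ ⊕ U) ⇔ (λ(μ ⊕ U), 1 + λ) ∈ 𝒞 ⇔ M(zμ, z) ∈ 𝒞
  correspondence-affine : ∀ z μ → z ≢ zeroF → T (z *F μ , z) ⇔ inC (M (z *F μ , z))
  correspondence-affine z μ z≢0 =
    projective ⇔-∘ (⇔-sym (inC⇔solvable (μ ⊕ U)) ⇔-∘ (⇔-sym (solvable⇔¬DCond μ) ⇔-∘ T⇔¬DCond z μ z≢0))
    where
    projective : inC (lam *F (μ ⊕ U) , opl) ⇔ inC (M (z *F μ , z))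
    projective = mk⇔ (λ m → subst inC (sym (M-affine z μ)) (inC-scale z _ z≢0 m))
                     (λ m → inC-unscale z _ z≢0 (subst inC (M-affine z μ) m))

  correspondence : ∀ v → NonZero2 v → T v ⇔ inC (M v)
  correspondence (x , z) nz with ≡-dec _≟B_ z zeroF
  ... | yes refl = correspondence-∞ x (λ x≡0 → nz (cong₂ _,_ x≡0 refl))
  ... | no z≢0 with inverse z z≢0
  ... | z⁻¹ , inv = subst (λ x → T (x , z) ⇔ inC (M (x , z))) (sym x≡zμ) (correspondence-affine z (z⁻¹ *F x) z≢0)
    where
    x≡zμ : x ≡ z *F (z⁻¹ *F x)
    x≡zμ = trans (sym (*-oneˡ x)) (trans (cong (_*F x) (sym inv)) (*-assoc z z⁻¹ x))

-- Theorem 3.12.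
theorem3p12 : (h : ℕ) → 3 ≤ h → (c : Vec Bool h)
    → coef c (h ∸ 1) ≡ false → coef c (h ∸ 2) ≡ false
    → Field.Primitive c
    → (Field.RankH c × Field.Club c (h ∸ 2))
      × Σ (F h) λ a → Σ (F h) λ b → Σ (F h) λ c' → Σ (F h) λ d →
          Field.det c a b c' d ≢ Field.zeroF c
          × (∀ v → Field.NonZero2 c v → (Field.T c v ⇔ Field.inC c (Field.act c a b c' d v)))
theorem3p12 (suc (suc (suc k))) (s≤s (s≤s (s≤s _))) (c₀ ∷ ct) top-coef _ isPrimitive =
  (rank , club) , lam , lam *F U , zeroF , opl , det≢0 , correspondence
  where
  open Construction k c₀ ct (trans (sym (Bits.coef-last ct)) top-coef) isPrimitive
  open Field (c₀ ∷ ct) using (lam; _*F_; zeroF)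
  open PrimitiveField (suc k) c₀ ct isPrimitive using (opl)
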